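{- Let $1<n\le m$ and let $v$ be a vertex of $Z_{n,m}$ with $h(v)\ge h_{n,m}$ and $\sum_{i\in I_c(v)}v_i=0$. Then $d(v,0)\le d_{n,m}$.
   Context: Elements of $\mathbb{Z}_n$ are identified with their smallest nonnegative representatives in $\{0,\dots,n-1\}$ (so $v_0,v_{m+1}$ are integers in $[0,n-1]$ in sums). The dYoke graph $Z_{n,m}$ has as vertices all tuples $u=(u_0,\dots,u_{m+1})$ with $u_0,u_{m+1}\in\mathbb{Z}_n$, $u_1,\dots,u_m\in\{ -1,0,1\}$ and $\sum_{i=0}^{m+1}u_i\equiv0\pmod n$; adjacency: there is $0\le i\le m$ with $u_j=v_j$ for $j\notin\{i,i+1\}$ and either ($u_i=v_i+1$, $u_{i+1}=v_{i+1}-1$) or ($u_i=v_i-1$, $u_{i+1}=v_{i+1}+1$), arithmetic in coordinates $0,m+1$ in $\mathbb{Z}_n$. $0$ is the all-zero vertex, $d$ is graph distance. A pivot of $v$ is an integer $-1\le p\le m+1$ such that $n\mid\sum_{i=0}^{p}v_i$ (empty sum $=0$); $\operatorname{Piv}(v)$ is the set of pivots. $p_l(v)=\max\{p\in\operatorname{Piv}(v):p<\frac m2\}$, $p_r(v)=\min\{p\in\operatorname{Piv}(v):p\ge\frac m2\}$, $I_c(v)=[p_l(v)+1,p_r(v)]$. $h(v)=\min\{|p-\frac m2|:p\in\operatorname{Piv}(v)\}$; $h_{n,m}=\frac n2$ if $2\mid(m-n)$ and $\frac{n+1}{2}$ otherwise. $u^0_{n,m}$ is the vertex with $u_i=1$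 for $1\le i\le m$ and $u_0\equiv-\lfloor\frac{m-n}{2}\rfloor\pmod n$; $d^0_{n,m}=d(u^0_{n,m},0)$. For $n<m$ with $m-n$ odd, $u^1_{n,m}$ is the vertex with $u_{\lceil(m+1)/2\rceil}=0$, $u_i=1$ for the other $1\le i\le m$, $u_0\equiv-\lfloor\frac{m-n}{2}\rfloor\pmod n$; $d^1_{n,m}=d(u^1_{n,m},0)$. $d_{n,m}=d^0_{n,m}$ if $2\mid(m-n)$ and $\max\{d^0_{n,m},d^1_{n,m}\}$ otherwise. -}

module Defs where

open import Data.Nat as ℕ using (ℕ; zero; suc; _∸_)
open import Data.Nat.DivMod using (_/_; _%_)
open import Data.Integer as ℤ using (ℤ; +_; -_; _-_; ∣_∣; _≤_; _<_; 0ℤ; 1ℤ)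
open import Data.Integer.DivMod using (_%ℕ_)
open import Data.Integer.Divisibility using (_∣_)
open import Data.Product using (Σ; ∃; _×_)
open import Data.Sum using (_⊎_)
open import Data.Bool using (if_then_else_)
open import Relation.Binary.PropositionalEquality using (_≡_; _≢_)
open import Relation.Nullary using (¬_)

-- A tuple u = (u_0,…,u_{m+1}) is represented by a function ℕ → ℤ;
-- only the indices 0 … m+1 are meaningful (values beyond are ignored).
Tuple : Set
Tuple = ℕ → ℤ

psum : Tuple → ℕ → ℤ
psum u zero    = 0ℤ
psum u (suc k) = psum u k ℤ.+ u k

-- psumTo u p = Σ_{i=0}^{p} u_i   (for p ≥ -1; p = -1 gives the empty sum)
psumTo : Tuple → ℤ → ℤ
psumTo u p = psum u ∣ p ℤ.+ 1ℤ ∣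

-- Σ_{i=a}^{b} u_i  (for -1 ≤ a-1 ≤ b)
sumFromTo : Tuple → ℤ → ℤ → ℤ
sumFromTo u a b = psumTo u b - psumTo u (a - 1ℤ)

-- Vertices of Z_{n,m}: coordinates 0 and m+1 are elements of ℤ_n given by
-- their representative in {0,…,n-1}; inner coordinates lie in {-1,0,1};
-- the (integer) sum of all coordinates is divisible by n.
Vertex : ℕ → ℕ → Tuple → Set
Vertex n m u =
  (0ℤ ≤ u 0 × u 0 < + n) ×
  (0ℤ ≤ u (suc m) × u (suc m) < + n) ×
  (∀ i → 1 ℕ.≤ i → i ℕ.≤ m → (u i ≡ - 1ℤ ⊎ u i ≡ 0ℤ ⊎ u i ≡ 1ℤ)) ×
  (+ n ∣ psum u (suc (suc m)))

zeroV : Tuple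
zeroV _ = 0ℤ

IsEnd : ℕ → ℕ → Set
IsEnd m j = j ≡ 0 ⊎ j ≡ suc m

CoordEq : ℕ → ℕ → ℕ → ℤ → ℤ → Set
CoordEq n m j a b = (IsEnd m j × (+ n ∣ (a - b))) ⊎ (¬ IsEnd m j × a ≡ b)

Adj : ℕ → ℕ → Tuple → Tuple → Set
Adj n m u v = Σ ℕ λ i → (i ℕ.≤ m) ×
  (∀ j → j ℕ.≤ suc m → j ≢ i → j ≢ suc i → u j ≡ v j) ×
  ( (CoordEq n m i (u i) (v i ℤ.+ 1ℤ) × CoordEq n m (suc i) (u (suc i)) (v (suc i) - 1ℤ))
  ⊎ (CoordEq n m i (u i) (v i - 1ℤ) × CoordEq n m (suc i) (u (suc i)) (v (suc i) ℤ.+ 1ℤ)) )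

SameV : ℕ → Tuple → Tuple → Set
SameV m u v = ∀ j → j ℕ.≤ suc m → u j ≡ v j

-- Walk n m u w k : a walk of length k in Z_{n,m} from u to w
-- (every vertex after u is required to be a vertex of Z_{n,m}).
data Walk (n m : ℕ) : Tuple → Tuple → ℕ → Set where
  stop : ∀ {u w} → SameV m u w → Walk n m u w 0
  step : ∀ {u x w k} → Vertex n m x → Adj n m u x → Walk n m x w k → Walk n m u w (suc k)

DistLE : ℕ → ℕ → Tuple → Tuple → ℕ → Set
DistLE n m u w k = Σ ℕ λ j → (j ℕ.≤ k) × Walk n m u w j

Pivot : ℕ → ℕ → Tuple → ℤ → Set
Pivot n m v p = (- 1ℤ ≤ p) × (p ≤ + suc m) × (+ n ∣ psumTo v p)

IsPl : ℕ → ℕ → Tuple → ℤ → Set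
IsPl n m v p = Pivot n m v p × (+ 2 ℤ.* p < + m) ×
  (∀ q → Pivot n m v q → + 2 ℤ.* q < + m → q ≤ p)

IsPr : ℕ → ℕ → Tuple → ℤ → Set
IsPr n m v p = Pivot n m v p × (+ m ≤ + 2 ℤ.* p) ×
  (∀ q → Pivot n m v q → + m ≤ + 2 ℤ.* q → p ≤ q)

-- 2 · h_{n,m}  (= n if m-n even, n+1 otherwise; here n ≤ m)
twoH : ℕ → ℕ → ℕ
twoH n m = n ℕ.+ (m ∸ n) % 2

-- h(v) ≥ h_{n,m}, i.e. |p - m/2| ≥ h_{n,m} for every pivot p
-- (doubled to stay in ℤ: |2p - m| ≥ 2 h_{n,m})
HGe : ℕ → ℕ → Tuple → Set
HGe n m v = ∀ p → Pivot n m v p → twoH n m ℕ.≤ ∣ + 2 ℤ.* p - + m ∣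

-- Σ_{i ∈ I_c(v)} v_i = 0, with I_c(v) = [p_l(v)+1, p_r(v)]
CentralZero : ℕ → ℕ → Tuple → Set
CentralZero n m v = ∀ pl pr → IsPl n m v pl → IsPr n m v pr →
  sumFromTo v (pl ℤ.+ 1ℤ) pr ≡ 0ℤ

-- x mod n as a natural number in {0,…,n-1} (junk value 0 for n = 0)
modN : ℤ → ℕ → ℕ
modN x zero    = 0
modN x (suc k) = x %ℕ suc k

u0first : ℕ → ℕ → ℤ
u0first n m = + modN (- + ((m ∸ n) / 2)) n

-- u^0_{n,m}: u_i = 1 (1 ≤ i ≤ m), u_0 as above, u_{m+1} forced by the sum condition
u⁰ : ℕ → ℕ → Tuple
u⁰ n m zero    = u0first n m
u⁰ n m (suc i) =
  if suc i ℕ.≤ᵇ m then 1ℤ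
  else if suc i ℕ.≡ᵇ suc m then + modN (- (u0first n m ℤ.+ + m)) n
  else 0ℤ

-- index ⌈(m+1)/2⌉ = ⌊(m+2)/2⌋
cIdx : ℕ → ℕ
cIdx m = suc (suc m) / 2

-- u^1_{n,m} (meaningful for n < m, m-n odd): like u^0 but u_{⌈(m+1)/2⌉} = 0,
-- u_{m+1} again forced by the sum condition
u¹ : ℕ → ℕ → Tuple
u¹ n m zero    = u0first n m
u¹ n m (suc i) =
  if suc i ℕ.≡ᵇ cIdx m then 0ℤ
  else if suc i ℕ.≤ᵇ m then 1ℤ
  else if suc i ℕ.≡ᵇ suc m then + modN (- (u0first n m ℤ.+ + m - 1ℤ)) n
  else 0ℤ

-- d(v,0) ≤ d_{n,m}:
--  m-n even: d(v,0) ≤ d(u⁰,0), i.e. every k ≥ d(u⁰,0) satisfies k ≥ d(v,0);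
--  m-n odd : d(v,0) ≤ max(d(u⁰,0), d(u¹,0)), i.e. every k ≥ both satisfies k ≥ d(v,0).
DistLeD : ℕ → ℕ → Tuple → Set
DistLeD n m v =
  ((m ∸ n) % 2 ≡ 0 → ∀ k → DistLE n m (u⁰ n m) zeroV k → DistLE n m v zeroV k) ×
  ((m ∸ n) % 2 ≡ 1 → ∀ k → DistLE n m (u⁰ n m) zeroV k → DistLE n m (u¹ n m) zeroV k
                         → DistLE n m v zeroV k)

module Submission where

-- Write S_L(u) = u_0 + … + u_{L-1} (= psum u L).  The proof rests on the distance
-- formula  d(u,0) = min_k Φ_u(k)  with the potential  Φ_u(k) = Σ_{l=0}^{m} |S_{l+1}(u) - k n|:
--  * an edge changes one partial sum by ±1 and shifts all others by a common
--    multiple of n, so Φ rises by at most one per edge (distance-lower);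
--  * moving at a partial sum of largest deviation towards k n is an edge of
--    Z_{n,m} lowering Φ by exactly one (Greedy.distance-upper).
-- The potentials of u⁰ and u¹ are distance sums G(N,z) = Σ_{i<N} |i - z|, with
-- 4G(N+1,z) = (2z-N)² + N(N+2) on [0,N]; since u⁰_0 ≡ -c (mod n) for m = n + 2c + e,
-- 2z - (n+2c) is an odd multiple of n at every level z, giving lower bounds
-- (Split.u⁰-lower, Split.u¹-lower).  For v, the pivots p_l ≤ c and p_r ≥ m - c
-- enclose a strip in which S_L(v) stays strictly between q n and (q+1) n; a
-- pointwise comparison gives the matching upper bound (CentralStrip.v-bound).
-- The theorem compares the two bounds and applies the distance formula.

open import Defs
open import Data.Bool using (T; true; false)
open import Data.Unit using (tt)
open import Data.Nat as ℕ using (suc; s≤s; zero; z≤n; ℕ; _∸_)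
import Data.Nat.Properties as ℕP
import Data.Nat.Divisibility as ℕD
open import Data.Nat.DivMod using (_%_; _/_)
import Data.Nat.DivMod as ND
open import Data.Integer as ℤ using (+<+; +_; +≤+; -[1+_]; -_; -≤+; 0ℤ; 1ℤ; _*_; _+_; _-_; _<_; _≤_; ℤ; ∣_∣)
import Data.Integer.Properties as ℤP
open import Data.Integer.Tactic.RingSolver using (solve-∀)
open import Data.Integer.Divisibility using (_∣_)
import Data.Integer.Divisibility.Signed as DS
open import Data.Integer.DivMod using (_%ℕ_; _/ℕ_; a≡a%ℕn+[a/ℕn]*n; n%ℕd<d)
open import Data.Product using (_,_; _×_; proj₁; proj₂; Σ)
open import Data.Sum using (_⊎_; inj₁; inj₂; [_,_])
open import Relation.Binary.PropositionalEquality using (_≡_; _≢_; refl; sym; trans; cong; cong₂; subst; subst₂; module ≡-Reasoning)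
open import Relation.Binary.Definitions using (tri<; tri>; tri≈)
open import Relation.Nullary using (Dec; yes; no; ¬_)
open import Data.Empty using (⊥-elim)
open import Function using (_∘_; _$_)

abs : ℤ → ℤ
abs x = + ∣ x ∣

abs-nonneg : ∀ x → 0ℤ ≤ abs x
abs-nonneg x = +≤+ z≤n

abs-of-nonneg : ∀ {x} → 0ℤ ≤ x → abs x ≡ x
abs-of-nonneg = ℤP.0≤i⇒+∣i∣≡i

abs-of-nonpos : ∀ {x} → x ≤ 0ℤ → abs x ≡ - x
abs-of-nonpos {x} x≤0 =
  trans (cong +_ (sym (ℤP.∣-i∣≡∣i∣ x))) (abs-of-nonneg (ℤP.neg-mono-≤ x≤0))

≤abs : ∀ x → x ≤ abs x
≤abs (+ n)    = ℤP.≤-refl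
≤abs -[1+ n ] = -≤+

neg≤abs : ∀ x → - x ≤ abs x
neg≤abs x = subst (- x ≤_) (cong +_ (ℤP.∣-i∣≡∣i∣ x)) (≤abs (- x))

abs-triangle : ∀ x y → abs (x + y) ≤ abs x + abs y
abs-triangle x y = +≤+ (ℤP.∣i+j∣≤∣i∣+∣j∣ x y)

abs-flip : ∀ a b → abs (a - b) ≡ abs (b - a)
abs-flip a b = trans (cong abs (sym (flip a b))) (cong +_ (ℤP.∣-i∣≡∣i∣ (b - a)))
  where
  flip : ∀ a b → - (b - a) ≡ a - b
  flip = solve-∀

abs-square : ∀ x → abs x * abs x ≡ x * x
abs-square x with ℤP.+∣i∣≡i⊎+∣i∣≡-i x
... | inj₁ e = cong₂ _*_ e e
... | inj₂ e = trans (cong₂ _*_ e e) (neg-square x)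
  where
  neg-square : ∀ x → - x * - x ≡ x * x
  neg-square = solve-∀

nonneg-* : ∀ {a b} → 0ℤ ≤ a → 0ℤ ≤ b → 0ℤ ≤ a * b
nonneg-* {+ a} {+ b} _ _ = subst (0ℤ ≤_) (ℤP.pos-* a b) (+≤+ z≤n)

<⇒+1≤ : ∀ {a b} → a < b → a + 1ℤ ≤ b
<⇒+1≤ {a} {b} p = subst (_≤ b) (ℤP.+-comm 1ℤ a) (ℤP.i<j⇒suc[i]≤j p)

+1≤⇒< : ∀ {a b} → a + 1ℤ ≤ b → a < b
+1≤⇒< {a} {b} p = ℤP.suc[i]≤j⇒i<j (subst (_≤ b) (ℤP.+-comm a 1ℤ) p)

-- Linear arithmetic by certificate: a proof of  NonNegSum s  exhibits s as a sum
-- of differences B - A of known inequalities A ≤ B.  To prove X ≤ Y it then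
-- suffices that the ring solver confirms the identity  Y - X ≡ s.
infixr 5 _∷ₗ_
data NonNegSum : ℤ → Set where
  []ₗ  : NonNegSum 0ℤ
  _∷ₗ_ : ∀ {A B s} → A ≤ B → NonNegSum s → NonNegSum ((B - A) + s)

nonNegSum-nonneg : ∀ {s} → NonNegSum s → 0ℤ ≤ s
nonNegSum-nonneg []ₗ     = ℤP.≤-refl
nonNegSum-nonneg (p ∷ₗ l) = ℤP.+-mono-≤ (ℤP.i≤j⇒0≤j-i p) (nonNegSum-nonneg l)

by-certificate : ∀ {s X Y} → NonNegSum s → Y - X ≡ s → X ≤ Y
by-certificate l e = ℤP.0≤i-j⇒j≤i (subst (0ℤ ≤_) (sym e) (nonNegSum-nonneg l))

infix 6 _×ₗ_
_×ₗ_ : ∀ {A B} (k : ℕ) → A ≤ B → + k * A ≤ + k * B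
k ×ₗ p = ℤP.*-monoˡ-≤-nonNeg (+ k) p

halve-≤ : ∀ {X Y} → + 2 * X ≤ + 2 * Y → X ≤ Y
halve-≤ {X} {Y} p = ℤP.*-cancelʳ-≤-pos X Y (+ 2) (subst₂ _≤_ (ℤP.*-comm (+ 2) X) (ℤP.*-comm (+ 2) Y) p)

quarter-≤ : ∀ {X Y} → + 4 * X ≤ + 4 * Y + + 3 → X ≤ Y
quarter-≤ {X} {Y} 4X≤ = ℤP.≮⇒≥ λ Y<X → absurd (by-certificate (4 ×ₗ <⇒+1≤ Y<X ∷ₗ 4X≤ ∷ₗ []ₗ) (balance X Y))
  where
  absurd : ¬ (1ℤ ≤ 0ℤ)
  absurd (+≤+ ())
  balance : ∀ X Y → 0ℤ - 1ℤ ≡ (+ 4 * X - + 4 * (Y + 1ℤ)) + ((+ 4 * Y + + 3 - + 4 * X) + 0ℤ)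
  balance = solve-∀

square-mono : ∀ {a b} → 0ℤ ≤ a → a ≤ b → a * a ≤ b * b
square-mono {a} {b} 0≤a a≤b =
  by-certificate (nonneg-* (ℤP.i≤j⇒0≤j-i a≤b) (ℤP.+-mono-≤ (ℤP.≤-trans 0≤a a≤b) 0≤a) ∷ₗ []ₗ)
    (difference-of-squares a b)
  where
  difference-of-squares : ∀ a b → b * b - a * a ≡ (b - a) * (b + a) - 0ℤ + 0ℤ
  difference-of-squares = solve-∀

psum-mono : ∀ f g N → (∀ i → i ℕ.< N → f i ≤ g i) → psum f N ≤ psum g N
psum-mono f g zero    h = ℤP.≤-refl
psum-mono f g (suc N) h =
  ℤP.+-mono-≤ (psum-mono f g N (λ i p → h i (ℕP.m<n⇒m<1+n p))) (h N ℕP.≤-refl)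

psum-ext : ∀ f g N → (∀ i → i ℕ.< N → f i ≡ g i) → psum f N ≡ psum g N
psum-ext f g zero    h = refl
psum-ext f g (suc N) h = cong₂ _+_ (psum-ext f g N (λ i p → h i (ℕP.m<n⇒m<1+n p))) (h N ℕP.≤-refl)

psum-+ : ∀ f g N → psum (λ i → f i + g i) N ≡ psum f N + psum g N
psum-+ f g zero    = refl
psum-+ f g (suc N) = trans (cong (_+ (f N + g N)) (psum-+ f g N)) (regroup (psum f N) (psum g N) (f N) (g N))
  where
  regroup : ∀ a b c d → a + b + (c + d) ≡ a + c + (b + d)
  regroup = solve-∀

psum-const : ∀ c N → psum (λ _ → c) N ≡ + N * c
psum-const c zero    = refl
psum-const c (suc N) = trans (cong (_+ c) (psum-const c N)) (trans (distrib (+ N) c) (cong (_* c) (sym (ℤP.pos-+ 1 N))))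
  where
  distrib : ∀ a c → a * c + c ≡ (+ 1 + a) * c
  distrib = solve-∀

psum-nonneg : ∀ f N → (∀ i → i ℕ.< N → 0ℤ ≤ f i) → 0ℤ ≤ psum f N
psum-nonneg f N h =
  subst (_≤ psum f N) (trans (psum-const 0ℤ N) (ℤP.*-zeroʳ (+ N))) (psum-mono (λ _ → 0ℤ) f N h)

psum-change : ∀ f g i N → i ℕ.< N → (∀ l → l ℕ.< N → l ≢ i → g l ≡ f l) →
  psum g N ≡ psum f N + (g i - f i)
psum-change f g i (suc N) i<N same with i ℕ.≟ N
... | yes refl = begin
  psum g i + g i             ≡⟨ cong (_+ g i) (psum-ext g f i λ l l<i → same l (ℕP.m<n⇒m<1+n l<i) (ℕP.<⇒≢ l<i)) ⟩
  psum f i + g i             ≡⟨ last-changed (psum f i) (f i) (g i) ⟩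
  psum f i + f i + (g i - f i) ∎
  where
  open ≡-Reasoning
  last-changed : ∀ s a b → s + b ≡ s + a + (b - a)
  last-changed = solve-∀
... | no i≢N = begin
  psum g N + g N                     ≡⟨ cong₂ _+_ (psum-change f g i N (ℕP.≤∧≢⇒< (ℕP.≤-pred i<N) i≢N) (λ l l<N → same l (ℕP.m<n⇒m<1+n l<N)))
                                                   (same N ℕP.≤-refl (i≢N ∘ sym)) ⟩
  psum f N + (g i - f i) + f N       ≡⟨ earlier-changed (psum f N) (g i - f i) (f N) ⟩
  psum f N + f N + (g i - f i)       ∎
  where
  open ≡-Reasoning
  earlier-changed : ∀ s d a → s + d + a ≡ s + a + d
  earlier-changed = solve-∀

psum-change₂ : ∀ f g i N → suc i ℕ.< N → (∀ l → l ℕ.< N → l ≢ i → l ≢ suc i → g l ≡ f l) →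
  psum g N ≡ psum f N + (g i - f i) + (g (suc i) - f (suc i))
psum-change₂ f g i (suc N) i+1<N same with suc i ℕ.≟ N
... | yes refl = begin
  psum g (suc i) + g (suc i)
    ≡⟨ cong (_+ g (suc i)) (psum-change f g i (suc i) ℕP.≤-refl λ l l<i+1 l≢i →
         same l (ℕP.m<n⇒m<1+n l<i+1) l≢i (ℕP.<⇒≢ l<i+1)) ⟩
  psum f (suc i) + (g i - f i) + g (suc i)
    ≡⟨ last-changed (psum f (suc i)) (g i - f i) (f (suc i)) (g (suc i)) ⟩
  psum f (suc i) + f (suc i) + (g i - f i) + (g (suc i) - f (suc i)) ∎
  where
  open ≡-Reasoning
  last-changed : ∀ s d a b → s + d + b ≡ s + a + d + (b - a)
  last-changed = solve-∀
... | no i+1≢N = begin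
  psum g N + g N
    ≡⟨ cong₂ _+_ (psum-change₂ f g i N (ℕP.≤∧≢⇒< (ℕP.≤-pred i+1<N) i+1≢N) (λ l l<N → same l (ℕP.m<n⇒m<1+n l<N)))
                 (same N ℕP.≤-refl (λ e → ℕP.<-irrefl (sym e) (ℕP.<-trans (ℕP.n<1+n i) (ℕP.≤∧≢⇒< (ℕP.≤-pred i+1<N) i+1≢N))) (i+1≢N ∘ sym)) ⟩
  psum f N + (g i - f i) + (g (suc i) - f (suc i)) + f N
    ≡⟨ earlier-changed (psum f N) (g i - f i) (g (suc i) - f (suc i)) (f N) ⟩
  psum f N + f N + (g i - f i) + (g (suc i) - f (suc i)) ∎
  where
  open ≡-Reasoning
  earlier-changed : ∀ s d e a → s + d + e + a ≡ s + a + d + e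
  earlier-changed = solve-∀

-- The distance sum  G N z = Σ_{i<N} |i - z|.  Its closed form and lower bound below
-- are what the potentials of v, u⁰ and u¹ are compared against.
distSum : ℕ → ℤ → ℤ
distSum N z = psum (λ i → abs (+ i - z)) N

abs-below : ∀ i z → + i ≤ z → abs (+ i - z) ≡ z - + i
abs-below i z p = trans (abs-of-nonpos (ℤP.i≤j⇒i-j≤0 p)) (negate (+ i) z)
  where
  negate : ∀ a b → - (a - b) ≡ b - a
  negate = solve-∀

abs-above : ∀ i z → z ≤ + i → abs (+ i - z) ≡ + i - z
abs-above i z p = abs-of-nonneg (ℤP.i≤j⇒0≤j-i p)

distSum-right : ∀ N z → + N ≤ z →
  + 4 * distSum (suc N) z ≡ + 4 * ((+ N + 1ℤ) * z) - + 2 * (+ N * (+ N + 1ℤ))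
distSum-right zero z p = trans (cong (λ t → + 4 * (0ℤ + t)) (abs-below 0 z p)) (base z)
  where
  base : ∀ z → + 4 * (0ℤ + (z - 0ℤ)) ≡ + 4 * ((0ℤ + 1ℤ) * z) - + 2 * (0ℤ * (0ℤ + 1ℤ))
  base = solve-∀
distSum-right (suc N) z p = begin
  + 4 * (distSum (suc N) z + abs (+ suc N - z))
    ≡⟨ ℤP.*-distribˡ-+ (+ 4) (distSum (suc N) z) _ ⟩
  + 4 * distSum (suc N) z + + 4 * abs (+ suc N - z)
    ≡⟨ cong₂ _+_ (distSum-right N z (ℤP.≤-trans (+≤+ (ℕP.n≤1+n N)) p)) (cong (+ 4 *_) (abs-below (suc N) z p)) ⟩
  + 4 * ((+ N + 1ℤ) * z) - + 2 * (+ N * (+ N + 1ℤ)) + + 4 * (z - + suc N)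
    ≡⟨ cong (λ t → + 4 * ((+ N + 1ℤ) * z) - + 2 * (+ N * (+ N + 1ℤ)) + + 4 * (z - t)) (ℤP.pos-+ 1 N) ⟩
  + 4 * ((+ N + 1ℤ) * z) - + 2 * (+ N * (+ N + 1ℤ)) + + 4 * (z - (+ 1 + + N))
    ≡⟨ one-more (+ N) z ⟩
  + 4 * ((+ 1 + + N + 1ℤ) * z) - + 2 * ((+ 1 + + N) * (+ 1 + + N + 1ℤ))
    ≡⟨ cong (λ t → + 4 * ((t + 1ℤ) * z) - + 2 * (t * (t + 1ℤ))) (sym (ℤP.pos-+ 1 N)) ⟩
  + 4 * ((+ suc N + 1ℤ) * z) - + 2 * (+ suc N * (+ suc N + 1ℤ)) ∎
  where
  open ≡-Reasoning
  one-more : ∀ a z → + 4 * ((a + 1ℤ) * z) - + 2 * (a * (a + 1ℤ)) + + 4 * (z - (+ 1 + a))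
               ≡ + 4 * ((+ 1 + a + 1ℤ) * z) - + 2 * ((+ 1 + a) * (+ 1 + a + 1ℤ))
  one-more = solve-∀

distSum-closed : ∀ N z → 0ℤ ≤ z → z ≤ + N →
  + 4 * distSum (suc N) z ≡ (+ 2 * z - + N) * (+ 2 * z - + N) + + N * (+ N + + 2)
distSum-closed N z p q with z ℤ.≟ + N
... | yes refl = trans (distSum-right N (+ N) ℤP.≤-refl) (at-end (+ N))
  where
  at-end : ∀ a → + 4 * ((a + 1ℤ) * a) - + 2 * (a * (a + 1ℤ)) ≡ (+ 2 * a - a) * (+ 2 * a - a) + a * (a + + 2)
  at-end = solve-∀
distSum-closed zero z p q | no z≢N = ⊥-elim (z≢N (ℤP.≤-antisym q p))
distSum-closed (suc N) z p q | no z≢N = begin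
  + 4 * (distSum (suc N) z + abs (+ suc N - z))
    ≡⟨ ℤP.*-distribˡ-+ (+ 4) (distSum (suc N) z) _ ⟩
  + 4 * distSum (suc N) z + + 4 * abs (+ suc N - z)
    ≡⟨ cong₂ _+_ (distSum-closed N z p z≤N) (cong (+ 4 *_) (abs-above (suc N) z q)) ⟩
  (+ 2 * z - + N) * (+ 2 * z - + N) + + N * (+ N + + 2) + + 4 * (+ suc N - z)
    ≡⟨ cong (λ t → (+ 2 * z - + N) * (+ 2 * z - + N) + + N * (+ N + + 2) + + 4 * (t - z)) (ℤP.pos-+ 1 N) ⟩
  (+ 2 * z - + N) * (+ 2 * z - + N) + + N * (+ N + + 2) + + 4 * ((+ 1 + + N) - z)
    ≡⟨ one-more (+ N) z ⟩
  (+ 2 * z - (+ 1 + + N)) * (+ 2 * z - (+ 1 + + N)) + (+ 1 + + N) * ((+ 1 + + N) + + 2)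
    ≡⟨ cong (λ t → (+ 2 * z - t) * (+ 2 * z - t) + t * (t + + 2)) (sym (ℤP.pos-+ 1 N)) ⟩
  (+ 2 * z - + suc N) * (+ 2 * z - + suc N) + + suc N * (+ suc N + + 2) ∎
  where
  open ≡-Reasoning
  z≤N : z ≤ + N
  z≤N = ℤP.i<j⇒i≤pred[j] (ℤP.≤∧≢⇒< q z≢N)
  one-more : ∀ a z → (+ 2 * z - a) * (+ 2 * z - a) + a * (a + + 2) + + 4 * ((+ 1 + a) - z)
               ≡ (+ 2 * z - (+ 1 + a)) * (+ 2 * z - (+ 1 + a)) + (+ 1 + a) * ((+ 1 + a) + + 2)
  one-more = solve-∀

distSum-right-mono : ∀ N z → + N ≤ z → distSum (suc N) (+ N) ≤ distSum (suc N) z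
distSum-right-mono N z N≤z = psum-mono _ _ (suc N) λ i i<N →
  subst₂ _≤_ (sym (abs-below i (+ N) (+≤+ (ℕP.≤-pred i<N))))
             (sym (abs-below i z (ℤP.≤-trans (+≤+ (ℕP.≤-pred i<N)) N≤z)))
    (ℤP.+-monoˡ-≤ (- + i) N≤z)

distSum-left-mono : ∀ N z → z ≤ 0ℤ → distSum (suc N) 0ℤ ≤ distSum (suc N) z
distSum-left-mono N z z≤0 = psum-mono _ _ (suc N) λ i _ →
  subst₂ _≤_ (sym (abs-above i 0ℤ (+≤+ z≤n))) (sym (abs-above i z (ℤP.≤-trans z≤0 (+≤+ z≤n))))
    (ℤP.+-monoʳ-≤ (+ i) (ℤP.neg-mono-≤ z≤0))

distSum-lower : ∀ N z q → 0ℤ ≤ q → q ≤ + N → q ≤ abs (+ 2 * z - + N) →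
  q * q + + N * (+ N + + 2) ≤ + 4 * distSum (suc N) z
distSum-lower N z q 0≤q q≤N q≤w with ℤP.≤-total z 0ℤ | ℤP.≤-total z (+ N)
... | inj₁ z≤0 | _ = begin
  q * q + + N * (+ N + + 2)
    ≤⟨ ℤP.+-monoˡ-≤ _ (square-mono 0≤q q≤N) ⟩
  + N * + N + + N * (+ N + + 2)
    ≡⟨ cong (_+ + N * (+ N + + 2)) (at-zero (+ N)) ⟩
  (+ 2 * 0ℤ - + N) * (+ 2 * 0ℤ - + N) + + N * (+ N + + 2)
    ≡⟨ sym (distSum-closed N 0ℤ ℤP.≤-refl (+≤+ z≤n)) ⟩
  + 4 * distSum (suc N) 0ℤ
    ≤⟨ ℤP.*-monoˡ-≤-nonNeg (+ 4) (distSum-left-mono N z z≤0) ⟩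
  + 4 * distSum (suc N) z ∎
  where
  open ℤP.≤-Reasoning
  at-zero : ∀ a → a * a ≡ (+ 2 * 0ℤ - a) * (+ 2 * 0ℤ - a)
  at-zero = solve-∀
... | inj₂ 0≤z | inj₁ z≤N = begin
  q * q + + N * (+ N + + 2)
    ≤⟨ ℤP.+-monoˡ-≤ _ (square-mono 0≤q q≤w) ⟩
  abs (+ 2 * z - + N) * abs (+ 2 * z - + N) + + N * (+ N + + 2)
    ≡⟨ cong (_+ + N * (+ N + + 2)) (abs-square (+ 2 * z - + N)) ⟩
  (+ 2 * z - + N) * (+ 2 * z - + N) + + N * (+ N + + 2)
    ≡⟨ sym (distSum-closed N z 0≤z z≤N) ⟩
  + 4 * distSum (suc N) z ∎
  where open ℤP.≤-Reasoning
... | inj₂ _ | inj₂ N≤z = begin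
  q * q + + N * (+ N + + 2)
    ≤⟨ ℤP.+-monoˡ-≤ _ (square-mono 0≤q q≤N) ⟩
  + N * + N + + N * (+ N + + 2)
    ≡⟨ cong (_+ + N * (+ N + + 2)) (at-N (+ N)) ⟩
  (+ 2 * + N - + N) * (+ 2 * + N - + N) + + N * (+ N + + 2)
    ≡⟨ sym (distSum-closed N (+ N) (+≤+ z≤n) ℤP.≤-refl) ⟩
  + 4 * distSum (suc N) (+ N)
    ≤⟨ ℤP.*-monoˡ-≤-nonNeg (+ 4) (distSum-right-mono N z N≤z) ⟩
  + 4 * distSum (suc N) z ∎
  where
  open ℤP.≤-Reasoning
  at-N : ∀ a → a * a ≡ (+ 2 * a - a) * (+ 2 * a - a)
  at-N = solve-∀

quotient : ∀ {n x} → + n ∣ x → Σ ℤ λ α → x ≡ α * + n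
quotient p with DS.∣ᵤ⇒∣ p
... | DS.divides q eq = q , eq

divides-by : ∀ {n x} α → x ≡ α * + n → + n ∣ x
divides-by α eq = DS.∣⇒∣ᵤ (DS.divides α eq)

-- The distance from a vertex u to 0 is exactly min_k Φ_u(k); the two halves
-- of this fact are  distance-lower  and  distance-upper  below.
potential : ℕ → ℕ → Tuple → ℤ → ℤ
potential n m u k = psum (λ l → abs (psum u (suc l) - k * + n)) (suc m)

coordEq-low : ∀ {n m i a b} → i ℕ.≤ m → CoordEq n m i a b →
  Σ ℤ λ α → (a ≡ b + α * + n) × (α ≡ 0ℤ ⊎ i ≡ 0)
coordEq-low {a = a} {b} i≤m (inj₁ (inj₁ i≡0 , dv)) with quotient dv
... | α , eq = α , trans (split a b) (cong (λ t → b + t) eq) , inj₂ i≡0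
  where
  split : ∀ a b → a ≡ b + (a - b)
  split = solve-∀
coordEq-low i≤m (inj₁ (inj₂ refl , _)) = ⊥-elim (ℕP.<-irrefl refl (s≤s i≤m))
coordEq-low {b = b} i≤m (inj₂ (_ , eq)) = 0ℤ , trans eq (sym (ℤP.+-identityʳ b)) , inj₁ refl

coordEq-inner : ∀ {n m j a b} → j ℕ.≤ m → j ≢ 0 → CoordEq n m j a b → a ≡ b
coordEq-inner j≤m j≢0 (inj₁ (inj₁ e , _))    = ⊥-elim (j≢0 e)
coordEq-inner j≤m j≢0 (inj₁ (inj₂ refl , _)) = ⊥-elim (ℕP.<-irrefl refl (s≤s j≤m))
coordEq-inner j≤m j≢0 (inj₂ (_ , eq))        = eq

-- An edge from u to x, in explicit form: x arises from u by moving δ = ±1 from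
-- coordinate i to coordinate i+1, where u_i = x_i + δ + α n and the wrap-around
-- α can only be nonzero at the end coordinate i = 0.
record Edge (n m : ℕ) (u x : Tuple) : Set where
  field
    i    : ℕ
    i≤m  : i ℕ.≤ m
    same : ∀ j → j ℕ.≤ suc m → j ≢ i → j ≢ suc i → u j ≡ x j
    δ    : ℤ
    absδ : abs δ ≡ 1ℤ
    α    : ℤ
    at-i : u i ≡ x i + δ + α * + n
    α≡0  : α ≡ 0ℤ ⊎ i ≡ 0
    at-i+1 : suc i ℕ.≤ m → u (suc i) ≡ x (suc i) - δ

edge : ∀ {n m u x} → Adj n m u x → Edge n m u x
edge (i , i≤m , same , inj₁ (cᵢ , cᵢ₊₁)) = record
  { i = i ; i≤m = i≤m ; same = same ; δ = 1ℤ ; absδ = refl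
  ; α = proj₁ (coordEq-low i≤m cᵢ) ; at-i = proj₁ (proj₂ (coordEq-low i≤m cᵢ))
  ; α≡0 = proj₂ (proj₂ (coordEq-low i≤m cᵢ)) ; at-i+1 = λ p → coordEq-inner p (λ ()) cᵢ₊₁ }
edge (i , i≤m , same , inj₂ (cᵢ , cᵢ₊₁)) = record
  { i = i ; i≤m = i≤m ; same = same ; δ = - 1ℤ ; absδ = refl
  ; α = proj₁ (coordEq-low i≤m cᵢ) ; at-i = proj₁ (proj₂ (coordEq-low i≤m cᵢ))
  ; α≡0 = proj₂ (proj₂ (coordEq-low i≤m cᵢ)) ; at-i+1 = λ p → coordEq-inner p (λ ()) cᵢ₊₁ }

-- Along an edge, after lowering the level k by α, every deviation S_{l+1} - k n
-- is unchanged except the one at l = i, which moves by -δ.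
module EdgeDeviations {n m : ℕ} {u x : Tuple} (E : Edge n m u x) where
  open Edge E

  private
    agree : ∀ L → L ℕ.≤ suc (suc m) → ∀ l → l ℕ.< L → l ≢ i → l ≢ suc i → x l ≡ u l
    agree L L≤ l l<L l≢i l≢i+1 = sym (same l (ℕP.≤-pred (ℕP.≤-trans l<L L≤)) l≢i l≢i+1)

  -- Off the edge position: before i nothing changes (and α = 0 unless i = 0),
  -- after i + 1 the two changes ±δ cancel and only the wrap α n remains.
  deviation-off : ∀ k l → l ℕ.≤ m → l ≢ i →
    psum x (suc l) - (k - α) * + n ≡ psum u (suc l) - k * + n
  deviation-off k l l≤m l≢i with ℕP.<-cmp l i
  ... | tri< l<i _ _ with α≡0
  ...   | inj₂ refl = ⊥-elim (ℕP.n≮0 l<i)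
  ...   | inj₁ refl = begin
    psum x (suc l) - (k - 0ℤ) * + n
      ≡⟨ cong (_- (k - 0ℤ) * + n) (psum-ext x u (suc l) λ j j<l →
           agree (suc l) (ℕP.≤-trans (s≤s l≤m) (ℕP.n≤1+n _)) j j<l
             (ℕP.<⇒≢ (ℕP.<-≤-trans j<l l<i)) (ℕP.<⇒≢ (ℕP.<-trans (ℕP.<-≤-trans j<l l<i) (ℕP.n<1+n i)))) ⟩
    psum u (suc l) - (k - 0ℤ) * + n
      ≡⟨ cong (λ t → psum u (suc l) - t * + n) (ℤP.+-identityʳ k) ⟩
    psum u (suc l) - k * + n ∎
    where open ≡-Reasoning
  deviation-off k l l≤m l≢i | tri≈ _ l≡i _ = ⊥-elim (l≢i l≡i)
  deviation-off k l l≤m l≢i | tri> _ _ i<l = begin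
    psum x (suc l) - (k - α) * + n
      ≡⟨ cong (_- (k - α) * + n) (psum-change₂ u x i (suc l) (s≤s i<l) (agree (suc l) (ℕP.≤-trans (s≤s l≤m) (ℕP.n≤1+n _)))) ⟩
    psum u (suc l) + (x i - u i) + (x (suc i) - u (suc i)) - (k - α) * + n
      ≡⟨ cong₂ (λ a b → psum u (suc l) + (x i - a) + (x (suc i) - b) - (k - α) * + n) at-i (at-i+1 (ℕP.≤-trans i<l l≤m)) ⟩
    psum u (suc l) + (x i - (x i + δ + α * + n)) + (x (suc i) - (x (suc i) - δ)) - (k - α) * + n
      ≡⟨ cancel (psum u (suc l)) (x i) (x (suc i)) δ α k (+ n) ⟩
    psum u (suc l) - k * + n ∎
    where
    open ≡-Reasoning
    cancel : ∀ s a b d w k N → s + (a - (a + d + w * N)) + (b - (b - d)) - (k - w) * N ≡ s - k * N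
    cancel = solve-∀

  deviation-at : ∀ k → psum x (suc i) - (k - α) * + n ≡ psum u (suc i) - k * + n - δ
  deviation-at k = begin
    psum x (suc i) - (k - α) * + n
      ≡⟨ cong (_- (k - α) * + n) (psum-change u x i (suc i) ℕP.≤-refl λ l l<i+1 l≢i →
           agree (suc i) (ℕP.≤-trans (s≤s i≤m) (ℕP.n≤1+n _)) l l<i+1 l≢i (ℕP.<⇒≢ l<i+1)) ⟩
    psum u (suc i) + (x i - u i) - (k - α) * + n
      ≡⟨ cong (λ a → psum u (suc i) + (x i - a) - (k - α) * + n) at-i ⟩
    psum u (suc i) + (x i - (x i + δ + α * + n)) - (k - α) * + n
      ≡⟨ cancel (psum u (suc i)) (x i) δ α k (+ n) ⟩
    psum u (suc i) - k * + n - δ ∎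
    where
    open ≡-Reasoning
    cancel : ∀ s a d w k N → s + (a - (a + d + w * N)) - (k - w) * N ≡ s - k * N - d
    cancel = solve-∀

  potential-edge : ∀ k → potential n m u k ≡
    potential n m x (k - α) + (abs (psum u (suc i) - k * + n) - abs (psum u (suc i) - k * + n - δ))
  potential-edge k = begin
    potential n m u k
      ≡⟨ psum-change (λ l → abs (psum x (suc l) - (k - α) * + n)) (λ l → abs (psum u (suc l) - k * + n)) i (suc m) (s≤s i≤m)
           (λ l l<m l≢i → cong abs (sym (deviation-off k l (ℕP.≤-pred l<m) l≢i))) ⟩
    potential n m x (k - α) + (abs (psum u (suc i) - k * + n) - abs (psum x (suc i) - (k - α) * + n))
      ≡⟨ cong (λ t → potential n m x (k - α) + (abs (psum u (suc i) - k * + n) - abs t)) (deviation-at k) ⟩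
    potential n m x (k - α) + (abs (psum u (suc i) - k * + n) - abs (psum u (suc i) - k * + n - δ)) ∎
    where open ≡-Reasoning

abs-drop-≤ : ∀ a d → abs a - abs (a - d) ≤ abs d
abs-drop-≤ a d = by-certificate (tri ∷ₗ []ₗ) (rearrange (abs a) (abs (a - d)) (abs d))
  where
  tri : abs a ≤ abs (a - d) + abs d
  tri = subst (λ t → abs t ≤ abs (a - d) + abs d) (undo a d) (abs-triangle (a - d) d)
    where
    undo : ∀ a d → a - d + d ≡ a
    undo = solve-∀
  rearrange : ∀ A B D → D - (A - B) ≡ B + D - A + 0ℤ
  rearrange = solve-∀

-- Lower half of the distance formula: one edge raises min_k Φ by at most one,
-- so a walk of length K from u to 0 yields a level k with Φ_u(k) ≤ K.
potential-edge-step : ∀ {n m u x} → Adj n m u x → ∀ k →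
  Σ ℤ λ k' → potential n m u k' ≤ potential n m x k + 1ℤ
potential-edge-step {n} {m} {u} {x} adj k = k + α , (begin
  potential n m u (k + α)
    ≡⟨ potential-edge (k + α) ⟩
  potential n m x (k + α - α) + (abs Y - abs (Y - δ))
    ≡⟨ cong (λ t → potential n m x t + (abs Y - abs (Y - δ))) (cancel k α) ⟩
  potential n m x k + (abs Y - abs (Y - δ))
    ≤⟨ ℤP.+-monoʳ-≤ (potential n m x k) (subst (abs Y - abs (Y - δ) ≤_) absδ (abs-drop-≤ Y δ)) ⟩
  potential n m x k + 1ℤ ∎)
  where
  E : Edge n m u x
  E = edge adj
  open Edge E
  open EdgeDeviations E
  open ℤP.≤-Reasoning
  Y : ℤ
  Y = psum u (suc i) - (k + α) * + n
  cancel : ∀ k a → k + a - a ≡ k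
  cancel = solve-∀

psum-of-zero : ∀ u L → (∀ j → j ℕ.< L → u j ≡ 0ℤ) → psum u L ≡ 0ℤ
psum-of-zero u L h = trans (psum-ext u (λ _ → 0ℤ) L h) (trans (psum-const 0ℤ L) (ℤP.*-zeroʳ (+ L)))

potential-of-zero : ∀ {n m u} → SameV m u zeroV → potential n m u 0ℤ ≡ 0ℤ
potential-of-zero {n} {m} {u} u≡0 = psum-of-zero _ (suc m) λ l l≤m →
  cong abs (trans (cong (_- 0ℤ * + n) (psum-of-zero u (suc l) λ j j≤l → u≡0 j (ℕP.<⇒≤ (ℕP.<-≤-trans j≤l l≤m)))) refl)

walk-potential : ∀ {n m u j} → Walk n m u zeroV j → Σ ℤ λ k → potential n m u k ≤ + j
walk-potential {n} {m} (stop u≡0) = 0ℤ , ℤP.≤-reflexive (potential-of-zero {n} {m} u≡0)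
walk-potential {n} {m} {u} {suc j} (step {x = x} _ adj w) with walk-potential w
... | k , Φ≤j with potential-edge-step adj k
...   | k' , Φ≤ = k' , ℤP.≤-trans Φ≤
        (subst (potential n m x k + 1ℤ ≤_) (ℤP.+-comm (+ j) 1ℤ) (ℤP.+-monoˡ-≤ 1ℤ Φ≤j))

distance-lower : ∀ {n m u K} → DistLE n m u zeroV K → Σ ℤ λ k → potential n m u k ≤ + K
distance-lower (j , j≤K , w) with walk-potential w
... | k , Φ≤j = k , ℤP.≤-trans Φ≤j (+≤+ j≤K)

InnerValue : ℤ → Set
InnerValue y = y ≡ - 1ℤ ⊎ y ≡ 0ℤ ⊎ y ≡ 1ℤ

Sign : ℤ → Set
Sign δ = δ ≡ 1ℤ ⊎ δ ≡ - 1ℤ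

sign*≤abs : ∀ {δ} a → Sign δ → δ * a ≤ abs a
sign*≤abs a (inj₁ refl) = subst (_≤ abs a) (sym (ℤP.*-identityˡ a)) (≤abs a)
sign*≤abs a (inj₂ refl) = subst (_≤ abs a) (sym (ℤP.-1*i≡-i a)) (neg≤abs a)

sign-dominates : ∀ {δ Y Y'} → Sign δ → δ * Y ≡ abs Y → abs Y' ≤ abs Y → δ * Y' ≤ δ * Y
sign-dominates {Y' = Y'} s δY≡ Y'≤Y = ℤP.≤-trans (sign*≤abs Y' s) (ℤP.≤-trans Y'≤Y (ℤP.≤-reflexive (sym δY≡)))

inner-minus : ∀ {δ y} → InnerValue y → Sign δ → 0ℤ ≤ δ * y → InnerValue (y - δ)
inner-minus (inj₁ refl)        (inj₁ refl) ()
inner-minus (inj₂ (inj₁ refl)) (inj₁ refl) _ = inj₁ refl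
inner-minus (inj₂ (inj₂ refl)) (inj₁ refl) _ = inj₂ (inj₁ refl)
inner-minus (inj₁ refl)        (inj₂ refl) _ = inj₂ (inj₁ refl)
inner-minus (inj₂ (inj₁ refl)) (inj₂ refl) _ = inj₂ (inj₂ refl)
inner-minus (inj₂ (inj₂ refl)) (inj₂ refl) ()

inner-plus : ∀ {δ y} → InnerValue y → Sign δ → δ * y ≤ 0ℤ → InnerValue (y + δ)
inner-plus (inj₁ refl)        (inj₁ refl) _ = inj₂ (inj₁ refl)
inner-plus (inj₂ (inj₁ refl)) (inj₁ refl) _ = inj₂ (inj₂ refl)
inner-plus (inj₂ (inj₂ refl)) (inj₁ refl) (+≤+ ())
inner-plus (inj₁ refl)        (inj₂ refl) (+≤+ ())
inner-plus (inj₂ (inj₁ refl)) (inj₂ refl) _ = inj₁ refl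
inner-plus (inj₂ (inj₂ refl)) (inj₂ refl) _ = inj₂ (inj₁ refl)

abs-step-toward-zero : ∀ {δ Y} → Sign δ → δ * Y ≡ abs Y → 1ℤ ≤ abs Y → abs (Y - δ) + 1ℤ ≡ abs Y
abs-step-toward-zero {Y = Y} (inj₁ refl) δY≡ 1≤ = begin
  abs (Y - 1ℤ) + 1ℤ ≡⟨ cong (_+ 1ℤ) (abs-of-nonneg (ℤP.i≤j⇒0≤j-i 1≤Y)) ⟩
  Y - 1ℤ + 1ℤ       ≡⟨ undo Y ⟩
  Y                 ≡⟨ sym (abs-of-nonneg (ℤP.≤-trans (+≤+ z≤n) 1≤Y)) ⟩
  abs Y             ∎
  where
  open ≡-Reasoning
  1≤Y : 1ℤ ≤ Y
  1≤Y = subst (1ℤ ≤_) (trans (sym δY≡) (ℤP.*-identityˡ Y)) 1≤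
  undo : ∀ Y → Y - 1ℤ + 1ℤ ≡ Y
  undo = solve-∀
abs-step-toward-zero {Y = Y} (inj₂ refl) δY≡ 1≤ = begin
  abs (Y - - 1ℤ) + 1ℤ ≡⟨ cong (_+ 1ℤ) (abs-of-nonpos Y+1≤0) ⟩
  - (Y - - 1ℤ) + 1ℤ   ≡⟨ undo Y ⟩
  - Y                 ≡⟨ sym (abs-of-nonpos Y≤0) ⟩
  abs Y               ∎
  where
  open ≡-Reasoning
  1≤-Y : 1ℤ ≤ - Y
  1≤-Y = subst (1ℤ ≤_) (trans (sym δY≡) (ℤP.-1*i≡-i Y)) 1≤
  Y+1≤0 : Y - - 1ℤ ≤ 0ℤ
  Y+1≤0 = by-certificate (1≤-Y ∷ₗ []ₗ) (shift Y)
    where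
    shift : ∀ Y → 0ℤ - (Y - - 1ℤ) ≡ - Y - 1ℤ + 0ℤ
    shift = solve-∀
  Y≤0 : Y ≤ 0ℤ
  Y≤0 = ℤP.≤-trans (subst (_≤ Y - - 1ℤ) (ℤP.+-identityʳ Y) (ℤP.+-monoʳ-≤ Y (+≤+ z≤n))) Y+1≤0
  undo : ∀ Y → - (Y - - 1ℤ) + 1ℤ ≡ - Y
  undo = solve-∀

multiple-in-range : ∀ n k → 0ℤ ≤ k * + suc n → k * + suc n < + suc n → k ≡ 0ℤ
multiple-in-range n (+ zero) _ _ = refl
multiple-in-range n (+ suc a) _ lt = ⊥-elim (ℤP.<-irrefl refl (ℤP.<-≤-trans lt
  (subst (+ suc n ≤_) (sym (ℤP.pos-* (suc a) (suc n))) (+≤+ (ℕP.m≤m+n (suc n) (a ℕ.* suc n))))))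
multiple-in-range n -[1+ a ] le _ = ⊥-elim (ℤP.<-irrefl refl (ℤP.≤-<-trans le (ℤP.*-monoʳ-<-pos (+ suc n) (ℤ.-<+ {a} {0}))))

argmax : (f : ℕ → ℤ) (M : ℕ) → Σ ℕ λ j → j ℕ.≤ M × (∀ i → i ℕ.≤ M → f i ≤ f j)
argmax f zero = 0 , z≤n , λ { zero _ → ℤP.≤-refl }
argmax f (suc M) with argmax f M
... | j , j≤M , max with ℤP.≤-total (f j) (f (suc M))
...   | inj₁ le = suc M , ℕP.≤-refl , λ i i≤ → [ (λ p → ℤP.≤-trans (max i (ℕP.≤-pred p)) le) , (λ { refl → ℤP.≤-refl }) ] (ℕP.m≤n⇒m<n∨m≡n i≤)
...   | inj₂ ge = j , ℕP.m≤n⇒m≤1+n j≤M , λ i i≤ → [ (λ p → max i (ℕP.≤-pred p)) , (λ { refl → ge }) ] (ℕP.m≤n⇒m<n∨m≡n i≤)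

-- Upper half of the distance formula (for n ≥ 1): from Φ_u(k) ≤ K a walk of
-- length ≤ K from u to 0 is built greedily, always moving at a partial sum of
-- largest deviation |S_{l+1} - k n| one step towards k n.
module Greedy (n' m : ℕ) where
  n : ℕ
  n = suc n'

  InRange : ℤ → Set
  InRange y = 0ℤ ≤ y × y < + n

  wrap : ℤ → ℤ
  wrap v = + (v %ℕ n)

  wrap-eq : ∀ v → Σ ℤ λ β → wrap v ≡ v + β * + n
  wrap-eq v = - (v /ℕ n) , sym (begin
    v + - (v /ℕ n) * + n                         ≡⟨ cong (_+ - (v /ℕ n) * + n) (a≡a%ℕn+[a/ℕn]*n v n) ⟩
    wrap v + (v /ℕ n) * + n + - (v /ℕ n) * + n   ≡⟨ cancel (wrap v) (v /ℕ n) (+ n) ⟩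
    wrap v                                       ∎)
    where
    open ≡-Reasoning
    cancel : ∀ a q N → a + q * N + - q * N ≡ a
    cancel = solve-∀

  wrap-range : ∀ v → InRange (wrap v)
  wrap-range v = +≤+ z≤n , +<+ (n%ℕd<d v n)

  normalise : ℕ → ℤ → ℤ
  normalise zero    v = wrap v
  normalise (suc j) v with j ℕ.≟ m
  ... | yes _ = wrap v
  ... | no _  = v

  normalise-eq : ∀ j v → Σ ℤ λ β → normalise j v ≡ v + β * + n
  normalise-eq zero v = wrap-eq v
  normalise-eq (suc j) v with j ℕ.≟ m
  ... | yes _ = wrap-eq v
  ... | no _  = 0ℤ , sym (ℤP.+-identityʳ v)

  normalise-inner : ∀ j v → suc j ℕ.≤ m → normalise (suc j) v ≡ v
  normalise-inner j v j≤m with j ℕ.≟ m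
  ... | yes refl = ⊥-elim (ℕP.<-irrefl refl j≤m)
  ... | no _     = refl

  normalise-last : ∀ v → normalise (suc m) v ≡ wrap v
  normalise-last v with m ℕ.≟ m
  ... | yes _  = refl
  ... | no m≢m = ⊥-elim (m≢m refl)

  normalise-coordEq : ∀ j a b c → c ≡ a - b → CoordEq n m j a (normalise j c + b)
  normalise-coordEq zero a b c c≡ with wrap-eq c
  ... | β , eq = inj₁ (inj₁ refl , divides-by (- β) (trans (cong (λ t → a - (t + b)) (trans eq (cong (_+ β * + n) c≡))) (cancel a b β (+ n))))
    where
    cancel : ∀ a b β N → a - (a - b + β * N + b) ≡ - β * N
    cancel = solve-∀
  normalise-coordEq (suc j) a b c c≡ with j ℕ.≟ m | wrap-eq c
  ... | yes refl | β , eq = inj₁ (inj₂ refl , divides-by (- β) (trans (cong (λ t → a - (t + b)) (trans eq (cong (_+ β * + n) c≡))) (cancel a b β (+ n))))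
    where
    cancel : ∀ a b β N → a - (a - b + β * N + b) ≡ - β * N
    cancel = solve-∀
  ... | no j≢m | _ = inj₂ (not-end , trans (restore a b) (cong (_+ b) (sym c≡)))
    where
    not-end : ¬ IsEnd m (suc j)
    not-end (inj₁ ())
    not-end (inj₂ e) = j≢m (ℕP.suc-injective e)
    restore : ∀ a b → a ≡ a - b + b
    restore = solve-∀

  move : Tuple → ℕ → ℤ → Tuple
  move u i δ j with j ℕ.≟ i
  ... | yes _ = normalise i (u i - δ)
  ... | no _ with j ℕ.≟ suc i
  ...   | yes _ = normalise (suc i) (u (suc i) + δ)
  ...   | no _  = u j

  move-at : ∀ u i δ → move u i δ i ≡ normalise i (u i - δ)
  move-at u i δ with i ℕ.≟ i
  ... | yes _  = refl
  ... | no i≢i = ⊥-elim (i≢i refl)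

  move-next : ∀ u i δ → move u i δ (suc i) ≡ normalise (suc i) (u (suc i) + δ)
  move-next u i δ with suc i ℕ.≟ i
  ... | yes e = ⊥-elim (ℕP.<-irrefl (sym e) (ℕP.n<1+n i))
  ... | no _ with suc i ℕ.≟ suc i
  ...   | yes _  = refl
  ...   | no ≢ = ⊥-elim (≢ refl)

  move-off : ∀ u i δ j → j ≢ i → j ≢ suc i → move u i δ j ≡ u j
  move-off u i δ j j≢i j≢i+1 with j ℕ.≟ i
  ... | yes e = ⊥-elim (j≢i e)
  ... | no _ with j ℕ.≟ suc i
  ...   | yes e = ⊥-elim (j≢i+1 e)
  ...   | no _  = refl

  move-adj : ∀ u i δ → i ℕ.≤ m → Sign δ → Adj n m u (move u i δ)
  move-adj u i δ i≤m s = i , i≤m , (λ j _ j≢i j≢i+1 → sym (move-off u i δ j j≢i j≢i+1)) , coords s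
    where
    at-i : CoordEq n m i (u i) (move u i δ i + δ)
    at-i = subst (λ t → CoordEq n m i (u i) (t + δ)) (sym (move-at u i δ)) (normalise-coordEq i (u i) δ (u i - δ) refl)
    at-i+1 : CoordEq n m (suc i) (u (suc i)) (move u i δ (suc i) - δ)
    at-i+1 = subst (λ t → CoordEq n m (suc i) (u (suc i)) (t - δ)) (sym (move-next u i δ))
               (normalise-coordEq (suc i) (u (suc i)) (- δ) (u (suc i) + δ) (add-back (u (suc i)) δ))
      where
      add-back : ∀ a d → a + d ≡ a - - d
      add-back = solve-∀
    x : Tuple
    x = move u i δ
    coords : Sign δ →
      (CoordEq n m i (u i) (x i + 1ℤ) × CoordEq n m (suc i) (u (suc i)) (x (suc i) - 1ℤ)) ⊎
      (CoordEq n m i (u i) (x i - 1ℤ) × CoordEq n m (suc i) (u (suc i)) (x (suc i) + 1ℤ))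
    coords (inj₁ refl) = inj₁ (at-i , at-i+1)
    coords (inj₂ refl) = inj₂ (at-i , at-i+1)

  -- A move changes the total sum by a multiple of n (the wrap-arounds at the ends).
  move-total : ∀ u i δ → i ℕ.≤ m → + n ∣ psum u (suc (suc m)) → + n ∣ psum (move u i δ) (suc (suc m))
  move-total u i δ i≤m total with quotient {x = psum u (suc (suc m))} total | normalise-eq i (u i - δ) | normalise-eq (suc i) (u (suc i) + δ)
  ... | γ , eγ | β₁ , e₁ | β₂ , e₂ = divides-by (γ + β₁ + β₂) (begin
    psum x (suc (suc m))
      ≡⟨ psum-change₂ u x i (suc (suc m)) (s≤s (s≤s i≤m)) (λ j _ j≢i j≢i+1 → move-off u i δ j j≢i j≢i+1) ⟩
    psum u (suc (suc m)) + (x i - u i) + (x (suc i) - u (suc i))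
      ≡⟨ cong₂ (λ a b → psum u (suc (suc m)) + (a - u i) + (b - u (suc i))) (trans (move-at u i δ) e₁) (trans (move-next u i δ) e₂) ⟩
    psum u (suc (suc m)) + (u i - δ + β₁ * + n - u i) + (u (suc i) + δ + β₂ * + n - u (suc i))
      ≡⟨ cong (λ t → t + (u i - δ + β₁ * + n - u i) + (u (suc i) + δ + β₂ * + n - u (suc i))) eγ ⟩
    γ * + n + (u i - δ + β₁ * + n - u i) + (u (suc i) + δ + β₂ * + n - u (suc i))
      ≡⟨ collect γ β₁ β₂ (u i) (u (suc i)) δ (+ n) ⟩
    (γ + β₁ + β₂) * + n ∎)
    where
    open ≡-Reasoning
    x : Tuple
    x = move u i δ
    collect : ∀ g b₁ b₂ a b d N → g * N + (a - d + b₁ * N - a) + (b + d + b₂ * N - b) ≡ (g + b₁ + b₂) * N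
    collect = solve-∀

  -- A move stays inside Z_{n,m} as long as the two touched inner coordinates
  -- remain in {-1,0,1}: the end coordinates are re-normalised into [0,n).
  move-vertex : ∀ u i δ → i ℕ.≤ m → Vertex n m u →
    (1 ℕ.≤ i → InnerValue (u i - δ)) → (suc i ℕ.≤ m → InnerValue (u (suc i) + δ)) →
    Vertex n m (move u i δ)
  move-vertex u i δ i≤m (first , last , inner , total) inner-i inner-i+1 =
    first′ i , last′ (i ℕ.≟ m) , inner′ , move-total u i δ i≤m total
    where
    x : Tuple
    x = move u i δ
    first′ : ∀ i → InRange (move u i δ 0)
    first′ zero     = subst InRange (sym (move-at u 0 δ)) (wrap-range (u 0 - δ))
    first′ (suc i′) = subst InRange (sym (move-off u (suc i′) δ 0 (λ ()) (λ ()))) first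
    last′ : Dec (i ≡ m) → InRange (x (suc m))
    last′ (yes refl) = subst InRange (sym (trans (move-next u i δ) (normalise-last _))) (wrap-range (u (suc i) + δ))
    last′ (no i≢m)   = subst InRange (sym (move-off u i δ (suc m) (λ e → ℕP.<-irrefl (sym e) (s≤s i≤m)) (i≢m ∘ sym ∘ ℕP.suc-injective))) last
    inner′ : ∀ j → 1 ℕ.≤ j → j ℕ.≤ m → InnerValue (x j)
    inner′ j 1≤j j≤m = by-position (j ℕ.≟ i) (j ℕ.≟ suc i)
      where
      stored-inner : ∀ j → 1 ℕ.≤ j → j ℕ.≤ m → InnerValue (u j - δ) → InnerValue (normalise j (u j - δ))
      stored-inner (suc j) _ j<m iv = subst InnerValue (sym (normalise-inner j _ j<m)) iv
      by-position : Dec (j ≡ i) → Dec (j ≡ suc i) → InnerValue (x j)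
      by-position (yes refl) _ = subst InnerValue (sym (move-at u j δ)) (stored-inner j 1≤j j≤m (inner-i 1≤j))
      by-position (no _) (yes refl) = subst InnerValue (sym (trans (move-next u i δ) (normalise-inner i _ j≤m))) (inner-i+1 j≤m)
      by-position (no j≢i) (no j≢i+1) = subst InnerValue (sym (move-off u i δ j j≢i j≢i+1)) (inner j 1≤j j≤m)
  -- If every partial sum S_1,…,S_{m+1} of a vertex equals the same k n, the
  -- vertex is 0: u_0 = k n ∈ [0,n) forces k = 0, and likewise for u_{m+1}.
  flat-vertex-zero : ∀ u k → Vertex n m u → (∀ l → l ℕ.≤ m → psum u (suc l) ≡ k * + n) → SameV m u zeroV
  flat-vertex-zero u k (first , last , _ , total) flat = same
    where
    u₀ : u 0 ≡ k * + n
    u₀ = trans (sym (ℤP.+-identityˡ (u 0))) (flat 0 z≤n)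
    k≡0 : k ≡ 0ℤ
    k≡0 = multiple-in-range n' k (subst (0ℤ ≤_) u₀ (proj₁ first)) (subst (_< + n) u₀ (proj₂ first))
    S≡0 : ∀ l → l ℕ.≤ m → psum u (suc l) ≡ 0ℤ
    S≡0 l l≤m = trans (flat l l≤m) (cong (_* + n) k≡0)
    same : SameV m u zeroV
    same zero _ = trans u₀ (cong (_* + n) k≡0)
    same (suc j) j<m+1 with ℕP.m≤n⇒m<n∨m≡n j<m+1
    ... | inj₁ j<m = begin
      u (suc j)                           ≡⟨ difference (psum u (suc j)) (u (suc j)) ⟩
      psum u (suc (suc j)) - psum u (suc j) ≡⟨ cong₂ _-_ (S≡0 (suc j) (ℕP.≤-pred j<m)) (S≡0 j (ℕP.<⇒≤ (ℕP.≤-pred j<m))) ⟩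
      0ℤ                                  ∎
      where
      open ≡-Reasoning
      difference : ∀ s a → a ≡ s + a - s
      difference = solve-∀
    ... | inj₂ refl with quotient {x = psum u (suc (suc m))} total
    ...   | γ , eγ = trans u-last (cong (_* + n) γ≡0)
      where
      u-last : u (suc m) ≡ γ * + n
      u-last = trans (sym (ℤP.+-identityˡ (u (suc m)))) (trans (cong (_+ u (suc m)) (sym (S≡0 m ℕP.≤-refl))) eγ)
      γ≡0 : γ ≡ 0ℤ
      γ≡0 = multiple-in-range n' γ (subst (0ℤ ≤_) u-last (proj₁ last)) (subst (_< + n) u-last (proj₂ last))

  record Descent (u : Tuple) (k : ℤ) : Set where
    field
      next     : Tuple
      vertex   : Vertex n m next
      adj      : Adj n m u next
      level    : ℤ
      descends : potential n m next level + 1ℤ ≡ potential n m u k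

  deviation : Tuple → ℤ → ℕ → ℤ
  deviation u k l = psum u (suc l) - k * + n

  move-potential : ∀ u k j δ (j≤m : j ℕ.≤ m) (s : Sign δ) →
    potential n m u k ≡ potential n m (move u j δ) (k - Edge.α (edge (move-adj u j δ j≤m s)))
                        + (abs (deviation u k j) - abs (deviation u k j - δ))
  move-potential u k j δ j≤m (inj₁ refl) = EdgeDeviations.potential-edge (edge (move-adj u j 1ℤ j≤m (inj₁ refl))) k
  move-potential u k j δ j≤m (inj₂ refl) = EdgeDeviations.potential-edge (edge (move-adj u j (- 1ℤ) j≤m (inj₂ refl))) k

  -- Moving at a position j of maximal deviation Y ≠ 0 in the direction δ of Y
  -- keeps the inner coordinates admissible (u_j has the sign of δ, u_{j+1} the
  -- opposite one) and lowers the potential by exactly one.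
  descend : ∀ u k j → Vertex n m u → j ℕ.≤ m →
    (∀ l → l ℕ.≤ m → abs (deviation u k l) ≤ abs (deviation u k j)) →
    ∀ δ → Sign δ → δ * deviation u k j ≡ abs (deviation u k j) → 1ℤ ≤ abs (deviation u k j) → Descent u k
  descend u k j V@(_ , _ , inner , _) j≤m max δ s δY≡ 1≤ = record
    { next = x ; vertex = move-vertex u j δ j≤m V inner-j inner-j+1 ; adj = adj
    ; level = k - Edge.α (edge adj) ; descends = descends }
    where
    x : Tuple
    x = move u j δ
    adj : Adj n m u (move u j δ)
    adj = move-adj u j δ j≤m s
    Y : ℤ
    Y = deviation u k j
    dominates : ∀ l → l ℕ.≤ m → δ * deviation u k l ≤ δ * Y
    dominates l l≤m = sign-dominates s δY≡ (max l l≤m)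
    inner-at : ∀ i → 1 ℕ.≤ i → i ℕ.≤ m → δ * deviation u k (ℕ.pred i) ≤ δ * deviation u k i → InnerValue (u i - δ)
    inner-at (suc i) _ i<m dom = inner-minus (inner (suc i) (s≤s z≤n) i<m) s
      (by-certificate (dom ∷ₗ []ₗ) (step-up (psum u (suc i)) (u (suc i)) k (+ n) δ))
      where
      step-up : ∀ s a k N d → d * a - 0ℤ ≡ d * (s + a - k * N) - d * (s - k * N) + 0ℤ
      step-up = solve-∀
    inner-j : 1 ℕ.≤ j → InnerValue (u j - δ)
    inner-j 1≤j = inner-at j 1≤j j≤m (dominates (ℕ.pred j) (ℕP.≤-trans ℕP.pred[n]≤n j≤m))
    inner-j+1 : suc j ℕ.≤ m → InnerValue (u (suc j) + δ)
    inner-j+1 j<m = inner-plus (inner (suc j) (s≤s z≤n) j<m) s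
      (by-certificate (dominates (suc j) j<m ∷ₗ []ₗ) (step-down (psum u (suc j)) (u (suc j)) k (+ n) δ))
      where
      step-down : ∀ s a k N d → 0ℤ - d * a ≡ d * (s - k * N) - d * (s + a - k * N) + 0ℤ
      step-down = solve-∀
    descends : potential n m x (k - Edge.α (edge adj)) + 1ℤ ≡ potential n m u k
    descends = begin
      potential n m x (k - α) + 1ℤ
        ≡⟨ cong (λ t → potential n m x (k - α) + t) (sym one-lower) ⟩
      potential n m x (k - α) + (abs Y - abs (Y - δ))
        ≡⟨ sym (move-potential u k j δ j≤m s) ⟩
      potential n m u k ∎
      where
      open ≡-Reasoning
      open Edge (edge adj) using (α)
      one-lower : abs Y - abs (Y - δ) ≡ 1ℤ
      one-lower = trans (cong (_- abs (Y - δ)) (sym (abs-step-toward-zero s δY≡ 1≤))) (cancel (abs (Y - δ)))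
        where
        cancel : ∀ a → a + 1ℤ - a ≡ 1ℤ
        cancel = solve-∀

  greedy-step : ∀ u k → Vertex n m u → SameV m u zeroV ⊎ Descent u k
  greedy-step u k V with argmax (λ l → abs (deviation u k l)) m
  ... | j , j≤m , max with ℤP.<-cmp (deviation u k j) 0ℤ
  ... | tri< Y<0 _ _ = inj₂ (descend u k j V j≤m max (- 1ℤ) (inj₂ refl)
          (trans (ℤP.-1*i≡-i _) (sym (abs-of-nonpos (ℤP.<⇒≤ Y<0))))
          (subst (1ℤ ≤_) (sym (abs-of-nonpos (ℤP.<⇒≤ Y<0))) (ℤP.neg-mono-≤ (ℤP.i<j⇒i≤pred[j] Y<0))))
  ... | tri> _ _ 0<Y = inj₂ (descend u k j V j≤m max 1ℤ (inj₁ refl)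
          (trans (ℤP.*-identityˡ _) (sym (abs-of-nonneg (ℤP.<⇒≤ 0<Y))))
          (subst (1ℤ ≤_) (sym (abs-of-nonneg (ℤP.<⇒≤ 0<Y))) (ℤP.i<j⇒suc[i]≤j 0<Y)))
  ... | tri≈ _ Y≡0 _ = inj₁ (flat-vertex-zero u k V λ l l≤m → level-reached l (ℤP.∣i∣≡0⇒i≡0
          (ℤP.+-injective (ℤP.≤-antisym (ℤP.≤-trans (max l l≤m) (ℤP.≤-reflexive (cong abs Y≡0))) (abs-nonneg (deviation u k l))))))
    where
    level-reached : ∀ l → deviation u k l ≡ 0ℤ → psum u (suc l) ≡ k * + n
    level-reached l e = trans (restore (psum u (suc l)) (k * + n)) (trans (cong (_+ k * + n) e) (ℤP.+-identityˡ (k * + n)))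
      where
      restore : ∀ a b → a ≡ a - b + b
      restore = solve-∀

  potential-nonneg : ∀ u k → 0ℤ ≤ potential n m u k
  potential-nonneg u k = psum-nonneg _ (suc m) (λ l _ → abs-nonneg (deviation u k l))

  distance-upper : ∀ K u k → Vertex n m u → potential n m u k ≤ + K → DistLE n m u zeroV K
  distance-upper K u k V Φ≤K with greedy-step u k V
  ... | inj₁ u≡0 = 0 , z≤n , stop u≡0
  distance-upper zero u k V Φ≤0 | inj₂ d = ⊥-elim (ℤP.<-irrefl refl (ℤP.<-≤-trans 0<Φ Φ≤0))
    where
    open Descent d
    0<Φ : 0ℤ < potential n m u k
    0<Φ = subst (0ℤ <_) descends (+1≤⇒< (ℤP.+-monoˡ-≤ 1ℤ (potential-nonneg next level)))
  distance-upper (suc K) u k V Φ≤K | inj₂ d with distance-upper K next level vertex Φ′≤K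
    where
    open Descent d
    Φ′≤K : potential n m next level ≤ + K
    Φ′≤K = by-certificate (subst (_≤ + suc K) (sym descends) Φ≤K ∷ₗ []ₗ) (slack (potential n m next level) (+ K))
      where
      slack : ∀ a K → K - a ≡ (1ℤ + K) - (a + 1ℤ) + 0ℤ
      slack = solve-∀
  ... | j , j≤K , walk = suc j , s≤s j≤K , step (Descent.vertex d) (Descent.adj d) walk

T⇒≡true : ∀ {b} → T b → b ≡ true
T⇒≡true {true} _ = refl

¬T⇒≡false : ∀ {b} → ¬ T b → b ≡ false
¬T⇒≡false {false} _ = refl
¬T⇒≡false {true} ¬t = ⊥-elim (¬t tt)

≤ᵇ-true : ∀ {a b} → a ℕ.≤ b → (a ℕ.≤ᵇ b) ≡ true
≤ᵇ-true p = T⇒≡true (ℕP.≤⇒≤ᵇ p)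

≡ᵇ-true : ∀ {a b} → a ≡ b → (a ℕ.≡ᵇ b) ≡ true
≡ᵇ-true {a} {b} e = T⇒≡true (ℕP.≡⇒≡ᵇ a b e)

≡ᵇ-false : ∀ {a b} → a ≢ b → (a ℕ.≡ᵇ b) ≡ false
≡ᵇ-false {a} {b} ne = ¬T⇒≡false (λ t → ne (ℕP.≡ᵇ⇒≡ a b t))

u⁰-inner : ∀ n m i → suc i ℕ.≤ m → u⁰ n m (suc i) ≡ 1ℤ
u⁰-inner n m i p rewrite ≤ᵇ-true p = refl

u¹-centre : ∀ n m i → suc i ≡ cIdx m → u¹ n m (suc i) ≡ 0ℤ
u¹-centre n m i e rewrite ≡ᵇ-true e = refl

u¹-inner : ∀ n m i → suc i ≢ cIdx m → suc i ℕ.≤ m → u¹ n m (suc i) ≡ 1ℤ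
u¹-inner n m i ne p rewrite ≡ᵇ-false ne | ≤ᵇ-true p = refl

psum-ones : ∀ u L d → (∀ j → L ℕ.≤ j → j ℕ.< d ℕ.+ L → u (suc j) ≡ 1ℤ) →
  psum u (suc (d ℕ.+ L)) ≡ psum u (suc L) + + d
psum-ones u L zero    ones = sym (ℤP.+-identityʳ (psum u (suc L)))
psum-ones u L (suc d) ones = begin
  psum u (suc (d ℕ.+ L)) + u (suc (d ℕ.+ L))
    ≡⟨ cong₂ _+_ (psum-ones u L d (λ j L≤j j<d+L → ones j L≤j (ℕP.m<n⇒m<1+n j<d+L)))
                 (ones (d ℕ.+ L) (ℕP.m≤n+m L d) ℕP.≤-refl) ⟩
  psum u (suc L) + + d + 1ℤ
    ≡⟨ one-more (psum u (suc L)) (+ d) ⟩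
  psum u (suc L) + (1ℤ + + d) ∎
  where
  open ≡-Reasoning
  one-more : ∀ s d → s + d + 1ℤ ≡ s + (1ℤ + d)
  one-more = solve-∀

psum-from-start : ∀ u l → (∀ j → j ℕ.< l → u (suc j) ≡ 1ℤ) → psum u (suc l) ≡ u 0 + + l
psum-from-start u l ones = begin
  psum u (suc l)             ≡⟨ cong (λ t → psum u (suc t)) (sym (ℕP.+-identityʳ l)) ⟩
  psum u (suc (l ℕ.+ 0))     ≡⟨ psum-ones u 0 l (λ j _ j<l → ones j (subst (j ℕ.<_) (ℕP.+-identityʳ l) j<l)) ⟩
  0ℤ + u 0 + + l             ≡⟨ cong (_+ + l) (ℤP.+-identityˡ (u 0)) ⟩
  u 0 + + l                  ∎
  where open ≡-Reasoning

psum-u⁰ : ∀ n m l → l ℕ.≤ m → psum (u⁰ n m) (suc l) ≡ u0first n m + + l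
psum-u⁰ n m l l≤m = psum-from-start (u⁰ n m) l λ j j<l → u⁰-inner n m j (ℕP.≤-trans j<l l≤m)

psum-u¹-before : ∀ n m l → l ℕ.< cIdx m → l ℕ.≤ m → psum (u¹ n m) (suc l) ≡ u0first n m + + l
psum-u¹-before n m l l<c l≤m = psum-from-start (u¹ n m) l λ j j<l →
  u¹-inner n m j (ℕP.<⇒≢ (ℕP.≤-<-trans j<l l<c)) (ℕP.≤-trans j<l l≤m)

psum-u¹-after : ∀ n m c' → suc c' ≡ cIdx m → ∀ l → c' ℕ.≤ l → suc l ℕ.≤ m →
  psum (u¹ n m) (suc (suc l)) ≡ u0first n m + + l
psum-u¹-after n m c' centre l c'≤l l<m = begin
  psum u (suc (suc l))                  ≡⟨ cong (λ t → psum u (suc (suc t))) (sym d+c'≡l) ⟩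
  psum u (suc (suc (d ℕ.+ c')))         ≡⟨ cong (λ t → psum u (suc t)) (sym (ℕP.+-suc d c')) ⟩
  psum u (suc (d ℕ.+ suc c'))           ≡⟨ psum-ones u (suc c') d ones ⟩
  psum u (suc c') + u (suc c') + + d    ≡⟨ cong₂ (λ s x → s + x + + d) (psum-u¹-before n m c' (subst (c' ℕ.<_) centre ℕP.≤-refl) c'≤m)
                                                                      (u¹-centre n m c' centre) ⟩
  u0first n m + + c' + 0ℤ + + d         ≡⟨ regroup (u0first n m) (+ c') (+ d) ⟩
  u0first n m + + (d ℕ.+ c')            ≡⟨ cong (λ t → u0first n m + + t) d+c'≡l ⟩
  u0first n m + + l                     ∎
  where
  open ≡-Reasoning
  u : Tuple
  u = u¹ n m
  d : ℕ
  d = l ∸ c'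
  d+c'≡l : d ℕ.+ c' ≡ l
  d+c'≡l = ℕP.m∸n+n≡m c'≤l
  c'≤m : c' ℕ.≤ m
  c'≤m = ℕP.≤-trans c'≤l (ℕP.<⇒≤ l<m)
  ones : ∀ j → suc c' ℕ.≤ j → j ℕ.< d ℕ.+ suc c' → u (suc j) ≡ 1ℤ
  ones j c'<j j<end = u¹-inner n m j (λ e → ℕP.<-irrefl (trans centre (sym e)) (s≤s c'<j))
    (ℕP.≤-trans (s≤s (ℕP.≤-pred (subst (j ℕ.<_) (trans (ℕP.+-suc d c') (cong suc d+c'≡l)) j<end))) l<m)
  regroup : ∀ a c d → a + c + 0ℤ + d ≡ a + (d + c)
  regroup = solve-∀

psum-repeat : ∀ (g h : ℕ → ℤ) c N → suc c ℕ.≤ N → (∀ l → l ℕ.≤ c → h l ≡ g l) →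
  (∀ l → c ℕ.≤ l → suc l ℕ.≤ N → h (suc l) ≡ g l) → psum h (suc N) ≡ psum g N + g c
psum-repeat g h c (suc N) c<N before after with ℕP.m≤n⇒m<n∨m≡n (ℕP.≤-pred c<N)
... | inj₂ refl = cong₂ _+_ (psum-ext h g (suc c) (λ l l≤c → before l (ℕP.≤-pred l≤c))) (after c ℕP.≤-refl c<N)
... | inj₁ c<N′ = begin
  psum h (suc N) + h (suc N)
    ≡⟨ cong₂ _+_ (psum-repeat g h c N c<N′ before (λ l c≤l l<N → after l c≤l (ℕP.m≤n⇒m≤1+n l<N)))
                 (after N (ℕP.<⇒≤ c<N′) ℕP.≤-refl) ⟩
  psum g N + g c + g N
    ≡⟨ swap (psum g N) (g c) (g N) ⟩
  psum g N + g N + g c ∎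
  where
  open ≡-Reasoning
  swap : ∀ a b c → a + b + c ≡ a + c + b
  swap = solve-∀

deviation-shift : ∀ a l t → abs (a + l - t) ≡ abs (l - (t - a))
deviation-shift a l t = cong abs (regroup a l t)
  where
  regroup : ∀ a l t → a + l - t ≡ l - (t - a)
  regroup = solve-∀

potential-u⁰ : ∀ n m t → potential n m (u⁰ n m) t ≡ distSum (suc m) (t * + n - u0first n m)
potential-u⁰ n m t = psum-ext _ _ (suc m) λ l l≤m →
  trans (cong (λ s → abs (s - t * + n)) (psum-u⁰ n m l (ℕP.≤-pred l≤m))) (deviation-shift (u0first n m) (+ l) (t * + n))

potential-u¹ : ∀ n m c' → suc c' ≡ cIdx m → suc c' ℕ.≤ m → ∀ t →
  potential n m (u¹ n m) t ≡ distSum m (t * + n - u0first n m) + abs (+ c' - (t * + n - u0first n m))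
potential-u¹ n m c' centre c'<m t = psum-repeat _ _ c' m c'<m before after
  where
  before : ∀ l → l ℕ.≤ c' → abs (psum (u¹ n m) (suc l) - t * + n) ≡ abs (+ l - (t * + n - u0first n m))
  before l l≤c' = trans (cong (λ s → abs (s - t * + n)) (psum-u¹-before n m l (subst (l ℕ.<_) centre (s≤s l≤c')) (ℕP.≤-trans l≤c' (ℕP.<⇒≤ c'<m))))
                        (deviation-shift (u0first n m) (+ l) (t * + n))
  after : ∀ l → c' ℕ.≤ l → suc l ℕ.≤ m → abs (psum (u¹ n m) (suc (suc l)) - t * + n) ≡ abs (+ l - (t * + n - u0first n m))
  after l c'≤l l<m = trans (cong (λ s → abs (s - t * + n)) (psum-u¹-after n m c' centre l c'≤l l<m))
                           (deviation-shift (u0first n m) (+ l) (t * + n))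

div-mod-2 : ∀ x → x ≡ x % 2 ℕ.+ x / 2 ℕ.* 2
div-mod-2 x = ND.m≡m%n+[m/n]*n x 2

centre-index : ∀ m → 2 ℕ.≤ m →
  Σ ℕ λ c' → suc c' ≡ cIdx m × suc c' ℕ.≤ m × (+ 2 * + c' ≡ + m ⊎ + 2 * + c' + 1ℤ ≡ + m)
centre-index m@(suc (suc k)) _ = m / 2 , sym (ND.m/n≡1+[m∸n]/n (s≤s (s≤s (z≤n {m})))) ,
  ND.m/n<m m 2 (s≤s (s≤s z≤n)) , parity (m % 2) refl (ND.m%n<n m 2)
  where
  twice : ∀ c → + (c ℕ.* 2) ≡ + 2 * + c
  twice c = trans (ℤP.pos-* c 2) (ℤP.*-comm (+ c) (+ 2))
  parity : ∀ r → r ≡ m % 2 → r ℕ.< 2 → (+ 2 * + (m / 2) ≡ + m ⊎ + 2 * + (m / 2) + 1ℤ ≡ + m)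
  parity zero r≡ _ = inj₁ (trans (sym (twice (m / 2))) (cong +_ (sym (trans (div-mod-2 m) (cong (ℕ._+ m / 2 ℕ.* 2) (sym r≡))))))
  parity (suc zero) r≡ _ = inj₂ (trans (ℤP.+-comm (+ 2 * + (m / 2)) 1ℤ) (trans (cong (λ t → 1ℤ + t) (sym (twice (m / 2))))
    (cong +_ (sym (trans (div-mod-2 m) (cong (ℕ._+ m / 2 ℕ.* 2) (sym r≡)))))))
  parity (suc (suc _)) _ (s≤s (s≤s ()))
centre-index (suc zero) (s≤s ())

≤0⊎≥1 : ∀ r → r ≤ 0ℤ ⊎ 1ℤ ≤ r
≤0⊎≥1 (+ zero)  = inj₁ ℤP.≤-refl
≤0⊎≥1 (+ suc k) = inj₂ (+≤+ (s≤s z≤n))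
≤0⊎≥1 -[1+ k ]  = inj₁ -≤+

odd-multiple-≥ : ∀ N r → 0ℤ ≤ N → N ≤ abs ((+ 2 * r - 1ℤ) * N)
odd-multiple-≥ N r 0≤N with ≤0⊎≥1 r
... | inj₁ r≤0 = by-certificate (neg≤abs x ∷ₗ 2 ×ₗ nonneg-* (ℤP.i≤j⇒0≤j-i r≤0) 0≤N ∷ₗ []ₗ) (identity (abs x) r N)
  where
  x : ℤ
  x = (+ 2 * r - 1ℤ) * N
  identity : ∀ A r N → A - N ≡ (A - - ((+ 2 * r - 1ℤ) * N)) + ((+ 2 * ((0ℤ - r) * N) - + 2 * 0ℤ) + 0ℤ)
  identity = solve-∀
... | inj₂ 1≤r = by-certificate (≤abs x ∷ₗ 2 ×ₗ nonneg-* (ℤP.i≤j⇒0≤j-i 1≤r) 0≤N ∷ₗ []ₗ) (identity (abs x) r N)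
  where
  x : ℤ
  x = (+ 2 * r - 1ℤ) * N
  identity : ∀ A r N → A - N ≡ (A - (+ 2 * r - 1ℤ) * N) + ((+ 2 * ((r - 1ℤ) * N) - + 2 * 0ℤ) + 0ℤ)
  identity = solve-∀

half-far : ∀ N H r → (+ 2 * H ≡ N ⊎ + 2 * H ≡ N + 1ℤ) → 0ℤ ≤ N → N ≤ + 2 * abs (H - r * N) + 1ℤ
half-far N H r twoH 0≤N with ≤0⊎≥1 r
... | inj₁ r≤0 = by-certificate (2 ×ₗ ≤abs x ∷ₗ 2 ×ₗ nonneg-* (ℤP.i≤j⇒0≤j-i r≤0) 0≤N ∷ₗ N≤2H twoH ∷ₗ +≤+ (z≤n {1}) ∷ₗ []ₗ)
                   (identity (abs x) H r N)
  where
  x : ℤ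
  x = H - r * N
  N≤2H : (+ 2 * H ≡ N ⊎ + 2 * H ≡ N + 1ℤ) → N ≤ + 2 * H
  N≤2H (inj₁ e) = ℤP.≤-reflexive (sym e)
  N≤2H (inj₂ e) = subst (N ≤_) (sym e) (subst (_≤ N + 1ℤ) (ℤP.+-identityʳ N) (ℤP.+-monoʳ-≤ N (+≤+ z≤n)))
  identity : ∀ A H r N → + 2 * A + 1ℤ - N ≡
    (+ 2 * A - + 2 * (H - r * N)) + ((+ 2 * ((0ℤ - r) * N) - + 2 * 0ℤ) + ((+ 2 * H - N) + ((+ 1 - + 0) + 0ℤ)))
  identity = solve-∀
... | inj₂ 1≤r = by-certificate (2 ×ₗ neg≤abs x ∷ₗ 2 ×ₗ nonneg-* (ℤP.i≤j⇒0≤j-i 1≤r) 0≤N ∷ₗ 2H≤N+1 twoH ∷ₗ []ₗ)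
                   (identity (abs x) H r N)
  where
  x : ℤ
  x = H - r * N
  2H≤N+1 : (+ 2 * H ≡ N ⊎ + 2 * H ≡ N + 1ℤ) → + 2 * H ≤ N + 1ℤ
  2H≤N+1 (inj₁ e) = subst (_≤ N + 1ℤ) (sym e) (subst (_≤ N + 1ℤ) (ℤP.+-identityʳ N) (ℤP.+-monoʳ-≤ N (+≤+ z≤n)))
  2H≤N+1 (inj₂ e) = ℤP.≤-reflexive e
  identity : ∀ A H r N → + 2 * A + 1ℤ - N ≡
    (+ 2 * A - + 2 * - (H - r * N)) + ((+ 2 * ((r - 1ℤ) * N) - + 2 * 0ℤ) + ((N + 1ℤ - + 2 * H) + 0ℤ))
  identity = solve-∀

module Split (n' m : ℕ) (n≤m : suc n' ℕ.≤ m) where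
  n : ℕ
  n = suc n'
  c : ℕ
  c = (m ∸ n) / 2
  e : ℕ
  e = (m ∸ n) % 2
  m₀ : ℕ
  m₀ = n ℕ.+ c ℕ.* 2

  m≡e+m₀ : m ≡ e ℕ.+ m₀
  m≡e+m₀ = begin
    m                       ≡⟨ sym (ℕP.m∸n+n≡m n≤m) ⟩
    m ∸ n ℕ.+ n             ≡⟨ cong (ℕ._+ n) (div-mod-2 (m ∸ n)) ⟩
    e ℕ.+ c ℕ.* 2 ℕ.+ n     ≡⟨ ℕP.+-assoc e (c ℕ.* 2) n ⟩
    e ℕ.+ (c ℕ.* 2 ℕ.+ n)   ≡⟨ cong (e ℕ.+_) (ℕP.+-comm (c ℕ.* 2) n) ⟩
    e ℕ.+ m₀                ∎
    where open ≡-Reasoning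

  m₀-eq : + m₀ ≡ + n + + 2 * + c
  m₀-eq = cong (λ t → + n + t) (trans (ℤP.pos-* c 2) (ℤP.*-comm (+ c) (+ 2)))

  m-eq : + m ≡ + n + + 2 * + c + + e
  m-eq = trans (cong +_ m≡e+m₀) (trans (ℤP.+-comm (+ e) (+ m₀)) (cong (_+ + e) m₀-eq))

  a : ℤ
  a = u0first n m
  w : ℤ
  w = (- + c) /ℕ n

  a-eq : a ≡ - + c - w * + n
  a-eq = trans (add-and-remove a w (+ n)) (cong (_- w * + n) (sym (a≡a%ℕn+[a/ℕn]*n (- + c) n)))
    where
    add-and-remove : ∀ a w N → a ≡ a + w * N - w * N
    add-and-remove = solve-∀

  -- Hence 2z - m₀ is an odd multiple of n for every level z = t n - a, and the
  -- closed form of G puts the potential of u⁰ (and most of that of u¹) above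
  -- n² + m₀(m₀+2).
  distSum-at-level : ∀ t → + n * + n + + m₀ * (+ m₀ + + 2) ≤ + 4 * distSum (suc m₀) (t * + n - a)
  distSum-at-level t = distSum-lower m₀ (t * + n - a) (+ n) (+≤+ z≤n) (+≤+ (ℕP.m≤m+n n (c ℕ.* 2)))
    (subst (+ n ≤_) (cong abs (sym odd)) (odd-multiple-≥ (+ n) (t + w) (+≤+ z≤n)))
    where
    odd : + 2 * (t * + n - a) - + m₀ ≡ (+ 2 * (t + w) - 1ℤ) * + n
    odd = trans (cong₂ (λ x y → + 2 * (t * + n - x) - y) a-eq m₀-eq) (expand t w (+ n) (+ c))
      where
      expand : ∀ t w N C → + 2 * (t * N - (- C - w * N)) - (N + + 2 * C) ≡ (+ 2 * (t + w) - 1ℤ) * N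
      expand = solve-∀

  u⁰-lower : e ≡ 0 → ∀ t → + n * + n + + m * (+ m + + 2) ≤ + 4 * potential n m (u⁰ n m) t
  u⁰-lower e≡0 t = subst₂ (λ M G → + n * + n + + M * (+ M + + 2) ≤ + 4 * G) (sym m≡m₀)
    (sym (trans (potential-u⁰ n m t) (cong (λ M → distSum (suc M) (t * + n - a)) m≡m₀)))
    (distSum-at-level t)
    where
    m≡m₀ : m ≡ m₀
    m≡m₀ = trans m≡e+m₀ (cong (ℕ._+ m₀) e≡0)

  odd-m : e ≡ 1 → m ≡ suc m₀
  odd-m e≡1 = trans m≡e+m₀ (cong (ℕ._+ m₀) e≡1)

  -- The centre c' of u¹ (2c' = m or 2c' + 1 = m) satisfies 2(c' - c) ∈ {n, n+1}, so
  -- it lies at distance ≥ (n-1)/2 from every level z = t n - a.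
  centre-far : e ≡ 1 → ∀ c' → (+ 2 * + c' ≡ + m ⊎ + 2 * + c' + 1ℤ ≡ + m) → ∀ t →
    + n ≤ + 2 * abs (+ c' - (t * + n - a)) + 1ℤ
  centre-far e≡1 c' parity t = subst (λ x → + n ≤ + 2 * abs x + 1ℤ) shift (half-far (+ n) (+ c' - + c) (t + w) (half parity) (+≤+ z≤n))
    where
    shift : + c' - + c - (t + w) * + n ≡ + c' - (t * + n - a)
    shift = trans (regroup (+ c') (+ c) t w (+ n)) (cong (λ x → + c' - (t * + n - x)) (sym a-eq))
      where
      regroup : ∀ C' C t w N → C' - C - (t + w) * N ≡ C' - (t * N - (- C - w * N))
      regroup = solve-∀
    m-odd : + m ≡ + n + + 2 * + c + 1ℤ
    m-odd = trans m-eq (cong (λ E → + n + + 2 * + c + + E) e≡1)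
    half : (+ 2 * + c' ≡ + m ⊎ + 2 * + c' + 1ℤ ≡ + m) → (+ 2 * (+ c' - + c) ≡ + n ⊎ + 2 * (+ c' - + c) ≡ + n + 1ℤ)
    half (inj₁ 2c'≡m) = inj₂ (trans (double (+ c') (+ c)) (trans (cong (_- + 2 * + c) (trans 2c'≡m m-odd)) (cancel (+ n) (+ c))))
      where
      double : ∀ x y → + 2 * (x - y) ≡ + 2 * x - + 2 * y
      double = solve-∀
      cancel : ∀ N C → N + + 2 * C + 1ℤ - + 2 * C ≡ N + 1ℤ
      cancel = solve-∀
    half (inj₂ 2c'+1≡m) = inj₁ (trans (double (+ c') (+ c)) (trans (cong (λ x → x - 1ℤ - + 2 * + c) (trans 2c'+1≡m m-odd)) (cancel (+ n) (+ c))))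
      where
      double : ∀ x y → + 2 * (x - y) ≡ + 2 * x + 1ℤ - 1ℤ - + 2 * y
      double = solve-∀
      cancel : ∀ N C → N + + 2 * C + 1ℤ - 1ℤ - + 2 * C ≡ N
      cancel = solve-∀

  u¹-lower : e ≡ 1 → ∀ t → + n * + n + + m * + m + + 2 * + n ≤ + 4 * potential n m (u¹ n m) t + + 3
  u¹-lower e≡1 t with centre-index m (subst (2 ℕ.≤_) (sym (odd-m e≡1)) (s≤s (ℕP.≤-trans (s≤s z≤n) (ℕP.m≤m+n n (c ℕ.* 2)))))
  ... | c' , centre , c'<m , parity = begin
    + n * + n + + m * + m + + 2 * + n
      ≡⟨ cong (λ M → + n * + n + M * M + + 2 * + n) m-as-m₀ ⟩
    + n * + n + (+ m₀ + 1ℤ) * (+ m₀ + 1ℤ) + + 2 * + n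
      ≤⟨ by-certificate (distSum-at-level t ∷ₗ 2 ×ₗ centre-far e≡1 c' parity t ∷ₗ []ₗ) (identity (+ n) (+ m₀) G D) ⟩
    + 4 * (G + D) + + 3
      ≡⟨ cong (λ Φ → + 4 * Φ + + 3) (sym (trans (potential-u¹ n m c' centre c'<m t) (cong (λ M → distSum M z + D) m≡1+m₀))) ⟩
    + 4 * potential n m (u¹ n m) t + + 3 ∎
    where
    open ℤP.≤-Reasoning
    m≡1+m₀ : m ≡ suc m₀
    m≡1+m₀ = odd-m e≡1
    m-as-m₀ : + m ≡ + m₀ + 1ℤ
    m-as-m₀ = trans (cong +_ m≡1+m₀) (ℤP.+-comm 1ℤ (+ m₀))
    z : ℤ
    z = t * + n - a
    G : ℤ
    G = distSum (suc m₀) z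
    D : ℤ
    D = abs (+ c' - z)
    identity : ∀ N M G D → + 4 * (G + D) + + 3 - (N * N + (M + 1ℤ) * (M + 1ℤ) + + 2 * N) ≡
      (+ 4 * G - (N * N + M * (M + + 2))) + ((+ 2 * (+ 2 * D + 1ℤ) - + 2 * N) + 0ℤ)
    identity = solve-∀

last-satisfying : (P : ℕ → Set) → (∀ x → Dec (P x)) → ∀ B → P 0 →
  Σ ℕ λ Q → Q ℕ.≤ B × P Q × (∀ R → Q ℕ.< R → R ℕ.≤ B → ¬ P R)
last-satisfying P P? zero p0 = 0 , z≤n , p0 , λ R Q<R R≤0 → ⊥-elim (ℕP.<-irrefl refl (ℕP.<-≤-trans Q<R R≤0))
last-satisfying P P? (suc B) p0 with P? (suc B)
... | yes pB = suc B , ℕP.≤-refl , pB , λ R B<R R≤B → ⊥-elim (ℕP.<-irrefl refl (ℕP.<-≤-trans B<R R≤B))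
... | no ¬pB with last-satisfying P P? B p0
...   | Q , Q≤B , pQ , last = Q , ℕP.m≤n⇒m≤1+n Q≤B , pQ , λ R Q<R R≤ → later R Q<R (ℕP.m≤n⇒m<n∨m≡n R≤)
  where
  later : ∀ R → Q ℕ.< R → R ℕ.< suc B ⊎ R ≡ suc B → ¬ P R
  later R Q<R (inj₁ R≤B)  = last R Q<R (ℕP.≤-pred R≤B)
  later R Q<R (inj₂ refl) = ¬pB

first-satisfying : (P : ℕ → Set) → (∀ x → Dec (P x)) → ∀ B → P B →
  Σ ℕ λ Q → Q ℕ.≤ B × P Q × (∀ R → R ℕ.< Q → ¬ P R)
first-satisfying P P? zero pB = 0 , z≤n , pB , λ R ()
first-satisfying P P? (suc B) pB with P? 0
... | yes p0 = 0 , z≤n , p0 , λ R ()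
... | no ¬p0 with first-satisfying (λ x → P (suc x)) (λ x → P? (suc x)) B pB
...   | Q , Q≤B , pQ , first = suc Q , s≤s Q≤B , pQ , λ { zero _ → ¬p0 ; (suc R) (s≤s R<Q) → first R R<Q }

-- Pivots p ≥ -1 are handled through the prefix lengths P = p + 1 ∈ ℕ.
pivotAt : ℕ → ℤ
pivotAt P = + P - 1ℤ

psumTo-pivotAt : ∀ v P → psumTo v (pivotAt P) ≡ psum v P
psumTo-pivotAt v P = cong (λ t → psum v ∣ t ∣) (undo (+ P))
  where
  undo : ∀ a → a - 1ℤ + 1ℤ ≡ a
  undo = solve-∀

pivotAt-length : ∀ q → - 1ℤ ≤ q → pivotAt ∣ q + 1ℤ ∣ ≡ q
pivotAt-length q q≥-1 = trans (cong (_- 1ℤ) (abs-of-nonneg (ℤP.+-monoˡ-≤ 1ℤ q≥-1))) (undo q)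
  where
  undo : ∀ a → a + 1ℤ - 1ℤ ≡ a
  undo = solve-∀

divisible? : ∀ n x → Dec (+ n ∣ x)
divisible? n x = n ℕD.∣? ∣ x ∣

+suc : ∀ x → + suc x ≡ + x + 1ℤ
+suc x = trans (ℤP.pos-+ 1 x) (ℤP.+-comm (+ 1) (+ x))

+double : ∀ x → + (2 ℕ.* x) ≡ + 2 * + x
+double x = ℤP.pos-* 2 x

better-of-two : ∀ (f : ℤ → ℤ) x y → Σ ℤ λ k → + 2 * f k ≤ f x + f y
better-of-two f x y with ℤP.≤-total (f x) (f y)
... | inj₁ fx≤fy = x , subst (_≤ f x + f y) (twice (f x)) (ℤP.+-monoʳ-≤ (f x) fx≤fy)
  where
  twice : ∀ a → a + a ≡ + 2 * a
  twice = solve-∀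
... | inj₂ fy≤fx = y , subst (_≤ f x + f y) (twice (f y)) (ℤP.+-monoˡ-≤ (f y) fy≤fx)
  where
  twice : ∀ a → a + a ≡ + 2 * a
  twice = solve-∀

-- With P_l = p_l + 1 and
-- P_r = p_r + 1 the hypotheses give  P_l ≤ c + 1,  P_r ≥ m - c + 1  and
-- S_{P_r} = S_{P_l};  in between, the partial sums stay inside one open strip
-- (q n, (q+1) n).  Comparing each deviation with |i - c| + |i - (m-c)| then bounds
-- Φ_v(q) + Φ_v(q+1).
module CentralStrip (n' m : ℕ) (n≤m : suc n' ℕ.≤ m) (n≥2 : 1 ℕ.≤ n') (v : Tuple)
  (V : Vertex (suc n') m v) (HG : HGe (suc n') m v) (CZ : CentralZero (suc n') m v) where

  open Split n' m n≤m using (n; c; e; m-eq)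

  inner : ∀ j → 1 ℕ.≤ j → j ℕ.≤ m → InnerValue (v j)
  inner = proj₁ (proj₂ (proj₂ V))

  -- Prefix lengths P with n ∣ S_P and pivot P - 1 to the left / right of m/2.
  LeftPivot : ℕ → Set
  LeftPivot P = 2 ℕ.* P ℕ.≤ suc m × + n ∣ psum v P

  RightPivot : ℕ → Set
  RightPivot P = suc (suc m) ℕ.≤ 2 ℕ.* P × + n ∣ psum v P

  leftPivot? : ∀ P → Dec (LeftPivot P)
  leftPivot? P with 2 ℕ.* P ℕ.≤? suc m | divisible? n (psum v P)
  ... | yes a | yes b = yes (a , b)
  ... | no ¬a | _     = no (¬a ∘ proj₁)
  ... | _     | no ¬b = no (¬b ∘ proj₂)

  rightPivot? : ∀ P → Dec (RightPivot P)
  rightPivot? P with suc (suc m) ℕ.≤? 2 ℕ.* P | divisible? n (psum v P)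
  ... | yes a | yes b = yes (a , b)
  ... | no ¬a | _     = no (¬a ∘ proj₁)
  ... | _     | no ¬b = no (¬b ∘ proj₂)

  -- The searches are kept abstract so that P_l and P_r are never unfolded.
  abstract
    left-search : Σ ℕ λ Q → Q ℕ.≤ suc (suc m) × LeftPivot Q × (∀ R → Q ℕ.< R → R ℕ.≤ suc (suc m) → ¬ LeftPivot R)
    left-search = last-satisfying LeftPivot leftPivot? (suc (suc m)) (z≤n , (n ℕD.∣0))

    right-search : Σ ℕ λ Q → Q ℕ.≤ suc (suc m) × RightPivot Q × (∀ R → R ℕ.< Q → ¬ RightPivot R)
    right-search = first-satisfying RightPivot rightPivot? (suc (suc m))
      (ℕP.m≤m+n (suc (suc m)) (suc (suc (m ℕ.+ 0))) , proj₂ (proj₂ (proj₂ V)))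

    Pl : ℕ
    Pl = proj₁ left-search
    Pr : ℕ
    Pr = proj₁ right-search
    Pl≤m+2 : Pl ℕ.≤ suc (suc m)
    Pl≤m+2 = proj₁ (proj₂ left-search)
    Pr≤m+2 : Pr ℕ.≤ suc (suc m)
    Pr≤m+2 = proj₁ (proj₂ right-search)
    Pl-pivot : LeftPivot Pl
    Pl-pivot = proj₁ (proj₂ (proj₂ left-search))
    Pr-pivot : RightPivot Pr
    Pr-pivot = proj₁ (proj₂ (proj₂ right-search))
    Pl-last : ∀ R → Pl ℕ.< R → R ℕ.≤ suc (suc m) → ¬ LeftPivot R
    Pl-last = proj₂ (proj₂ (proj₂ left-search))
    Pr-first : ∀ R → R ℕ.< Pr → ¬ RightPivot R
    Pr-first = proj₂ (proj₂ (proj₂ right-search))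

  pivotAt-pivot : ∀ P → P ℕ.≤ suc (suc m) → + n ∣ psum v P → Pivot n m v (pivotAt P)
  pivotAt-pivot P P≤ n∣S = ℤP.+-monoˡ-≤ (- 1ℤ) (+≤+ (z≤n {P})) , ℤP.+-monoˡ-≤ (- 1ℤ) (+≤+ P≤) ,
    subst (+ n ∣_) (sym (psumTo-pivotAt v P)) n∣S

  Pl-is-pl : IsPl n m v (pivotAt Pl)
  Pl-is-pl = pivotAt-pivot Pl Pl≤m+2 (proj₂ Pl-pivot) ,
    +1≤⇒< (by-certificate (+≤+ (proj₁ Pl-pivot) ∷ₗ []ₗ)
      (trans (rearrange (+ m) (+ Pl)) (cong₂ (λ a b → a - b + 0ℤ) (sym (+suc m)) (sym (+double Pl))))) ,
    maximal
    where
    rearrange : ∀ M P → M - (+ 2 * (P - 1ℤ) + 1ℤ) ≡ M + 1ℤ - + 2 * P + 0ℤ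
    rearrange = solve-∀
    maximal : ∀ q → Pivot n m v q → + 2 * q < + m → q ≤ pivotAt Pl
    maximal q (q≥-1 , q≤ , n∣S) 2q<m = subst (_≤ pivotAt Pl) (pivotAt-length q q≥-1) (ℤP.+-monoˡ-≤ (- 1ℤ) (+≤+ Q≤Pl))
      where
      Q : ℕ
      Q = ∣ q + 1ℤ ∣
      +Q : + Q ≡ q + 1ℤ
      +Q = abs-of-nonneg (ℤP.+-monoˡ-≤ 1ℤ q≥-1)
      left : 2 ℕ.* Q ℕ.≤ suc m
      left = ℤP.drop‿+≤+ (by-certificate (<⇒+1≤ 2q<m ∷ₗ []ₗ)
        (trans (cong₂ _-_ (+suc m) (trans (+double Q) (cong (+ 2 *_) +Q))) (shift (+ m) q)))
        where
        shift : ∀ M q → M + 1ℤ - + 2 * (q + 1ℤ) ≡ M - (+ 2 * q + 1ℤ) + 0ℤ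
        shift = solve-∀
      Q≤m+2 : Q ℕ.≤ suc (suc m)
      Q≤m+2 = ℤP.drop‿+≤+ (subst (_≤ + suc (suc m)) (sym +Q) (subst (q + 1ℤ ≤_) (sym (+suc (suc m))) (ℤP.+-monoˡ-≤ 1ℤ q≤)))
      Q≤Pl : Q ℕ.≤ Pl
      Q≤Pl with Q ℕ.≤? Pl
      ... | yes Q≤Pl = Q≤Pl
      ... | no Q≰Pl  = ⊥-elim (Pl-last Q (ℕP.≰⇒> Q≰Pl) Q≤m+2 (left , n∣S))

  Pr-is-pr : IsPr n m v (pivotAt Pr)
  Pr-is-pr = pivotAt-pivot Pr Pr≤m+2 (proj₂ Pr-pivot) ,
    by-certificate (+≤+ (proj₁ Pr-pivot) ∷ₗ []ₗ)
      (trans (rearrange (+ m) (+ Pr)) (cong₂ (λ a b → a - b + 0ℤ) (sym (+double Pr)) (sym (trans (+suc (suc m)) (cong (_+ 1ℤ) (+suc m)))))) ,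
    minimal
    where
    rearrange : ∀ M P → + 2 * (P - 1ℤ) - M ≡ + 2 * P - (M + 1ℤ + 1ℤ) + 0ℤ
    rearrange = solve-∀
    minimal : ∀ q → Pivot n m v q → + m ≤ + 2 * q → pivotAt Pr ≤ q
    minimal q (q≥-1 , q≤ , n∣S) m≤2q = subst (pivotAt Pr ≤_) (pivotAt-length q q≥-1) (ℤP.+-monoˡ-≤ (- 1ℤ) (+≤+ Pr≤Q))
      where
      Q : ℕ
      Q = ∣ q + 1ℤ ∣
      +Q : + Q ≡ q + 1ℤ
      +Q = abs-of-nonneg (ℤP.+-monoˡ-≤ 1ℤ q≥-1)
      right : suc (suc m) ℕ.≤ 2 ℕ.* Q
      right = ℤP.drop‿+≤+ (by-certificate (m≤2q ∷ₗ []ₗ)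
        (trans (cong₂ _-_ (trans (+double Q) (cong (+ 2 *_) +Q)) (trans (+suc (suc m)) (cong (_+ 1ℤ) (+suc m)))) (shift (+ m) q)))
        where
        shift : ∀ M q → + 2 * (q + 1ℤ) - (M + 1ℤ + 1ℤ) ≡ + 2 * q - M + 0ℤ
        shift = solve-∀
      Pr≤Q : Pr ℕ.≤ Q
      Pr≤Q with Pr ℕ.≤? Q
      ... | yes Pr≤Q = Pr≤Q
      ... | no Pr≰Q  = ⊥-elim (Pr-first Q (ℕP.≰⇒> Pr≰Q) (right , n∣S))

  central-sum : psum v Pr ≡ psum v Pl
  central-sum = trans (restore (psum v Pr) (psum v Pl)) (trans (cong (_+ psum v Pl) difference) (ℤP.+-identityˡ (psum v Pl)))
    where
    restore : ∀ a b → a ≡ a - b + b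
    restore = solve-∀
    undo : ∀ a → a + 1ℤ - 1ℤ ≡ a
    undo = solve-∀
    difference : psum v Pr - psum v Pl ≡ 0ℤ
    difference = trans (cong₂ _-_ (sym (psumTo-pivotAt v Pr)) (sym (trans (cong (psumTo v) (undo (pivotAt Pl))) (psumTo-pivotAt v Pl))))
                   (CZ (pivotAt Pl) (pivotAt Pr) Pl-is-pl Pr-is-pr)

  -- h(v) ≥ h_{n,m} keeps both pivots away from the middle:
  -- P_l ≤ c + 1 and P_r ≥ m - c + 1.
  Pl-small : + Pl ≤ + c + 1ℤ
  Pl-small = halve-≤ (by-certificate (far ∷ₗ []ₗ)
    (trans (rearrange (+ n) (+ c) (+ e) (+ Pl)) (cong₂ (λ a b → - (+ 2 * (+ Pl - 1ℤ) - a) - b + 0ℤ) (sym m-eq) (sym (ℤP.pos-+ n e)))))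
    where
    w : ℤ
    w = + 2 * pivotAt Pl - + m
    far : + (n ℕ.+ e) ≤ - w
    far = subst (+ (n ℕ.+ e) ≤_)
      (abs-of-nonpos (ℤP.<⇒≤ (ℤP.<-≤-trans (ℤP.+-monoˡ-< (- + m) (proj₁ (proj₂ Pl-is-pl))) (ℤP.≤-reflexive (ℤP.+-inverseʳ (+ m))))))
      (+≤+ (HG (pivotAt Pl) (proj₁ Pl-is-pl)))
    rearrange : ∀ N C E P → + 2 * (C + 1ℤ) - + 2 * P ≡ - (+ 2 * (P - 1ℤ) - (N + + 2 * C + E)) - (N + E) + 0ℤ
    rearrange = solve-∀

  Pr-large : + m - + c + 1ℤ ≤ + Pr
  Pr-large = halve-≤ (by-certificate (far ∷ₗ []ₗ)
    (trans (cong (λ a → + 2 * + Pr - + 2 * (a - + c + 1ℤ)) m-eq)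
      (trans (rearrange (+ n) (+ c) (+ e) (+ Pr)) (cong₂ (λ a b → (+ 2 * (+ Pr - 1ℤ) - a) - b + 0ℤ) (sym m-eq) (sym (ℤP.pos-+ n e))))))
    where
    w : ℤ
    w = + 2 * pivotAt Pr - + m
    far : + (n ℕ.+ e) ≤ w
    far = subst (+ (n ℕ.+ e) ≤_) (abs-of-nonneg (ℤP.i≤j⇒0≤j-i (proj₁ (proj₂ Pr-is-pr)))) (+≤+ (HG (pivotAt Pr) (proj₁ Pr-is-pr)))
    rearrange : ∀ N C E P → + 2 * P - + 2 * ((N + + 2 * C + E) - C + 1ℤ) ≡ (+ 2 * (P - 1ℤ) - (N + + 2 * C + E)) - (N + E) + 0ℤ
    rearrange = solve-∀

  -- Since n ≥ 2 there are at least two prefix lengths strictly between P_l and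
  -- P_r, and none of them is a pivot.
  Pl+2≤Pr : suc (suc Pl) ℕ.≤ Pr
  Pl+2≤Pr = ℤP.drop‿+≤+ (by-certificate (Pl-small ∷ₗ +≤+ (s≤s n≥2) ∷ₗ +≤+ (z≤n {e}) ∷ₗ Pr-large ∷ₗ []ₗ)
    (trans (cong (λ t → + Pr - t) (trans (+suc (suc Pl)) (cong (_+ 1ℤ) (+suc Pl))))
           (rearrange (+ Pl) (+ Pr) (+ c) (+ e) (+ suc n') (+ m) m-eq)))
    where
    rearrange : ∀ P R C E N M → M ≡ N + + 2 * C + E →
      R - (P + 1ℤ + 1ℤ) ≡ (C + 1ℤ - P) + ((N - + 2) + ((E - + 0) + ((R - (M - C + 1ℤ)) + 0ℤ)))
    rearrange P R C E N M refl = identity P R C E N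
      where
      identity : ∀ P R C E N → R - (P + 1ℤ + 1ℤ) ≡ (C + 1ℤ - P) + ((N - + 2) + ((E - + 0) + ((R - (N + + 2 * C + E - C + 1ℤ)) + 0ℤ)))
      identity = solve-∀

  Pl≤m : Pl ℕ.≤ m
  Pl≤m = ℕP.≤-pred (ℕP.≤-pred (ℕP.≤-trans Pl+2≤Pr Pr≤m+2))

  no-pivot-between : ∀ Q → Pl ℕ.< Q → Q ℕ.< Pr → ¬ (+ n ∣ psum v Q)
  no-pivot-between Q Pl<Q Q<Pr n∣S with 2 ℕ.* Q ℕ.≤? suc m
  ... | yes left = Pl-last Q Pl<Q (ℕP.<⇒≤ (ℕP.<-≤-trans Q<Pr Pr≤m+2)) (left , n∣S)
  ... | no ¬left = Pr-first Q Q<Pr (ℕP.≰⇒> ¬left , n∣S)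

  Between : ℤ → ℤ → Set
  Between q S = q * + n < S × S < (q + 1ℤ) * + n

  above-multiple : ∀ q x → q * + n ≤ x → ¬ (+ n ∣ x) → q * + n < x
  above-multiple q x q≤x ¬n∣x = ℤP.≤∧≢⇒< q≤x (λ e → ¬n∣x (subst (+ n ∣_) e (divides-by q refl)))

  below-multiple : ∀ q x → x ≤ q * + n → ¬ (+ n ∣ x) → x < q * + n
  below-multiple q x x≤q ¬n∣x = ℤP.≤∧≢⇒< x≤q (λ e → ¬n∣x (subst (+ n ∣_) (sym e) (divides-by q refl)))

  stay-between : ∀ q S x → InnerValue x → Between q S → ¬ (+ n ∣ S + x) → Between q (S + x)
  stay-between q S x (inj₁ refl) (lo , hi) ¬n∣ =
    above-multiple q (S - 1ℤ) (subst (_≤ S - 1ℤ) (undo (q * + n)) (ℤP.+-monoˡ-≤ (- 1ℤ) (<⇒+1≤ lo))) ¬n∣ ,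
    ℤP.<-trans (+1≤⇒< (ℤP.≤-reflexive (redo S))) hi
    where
    undo : ∀ a → a + 1ℤ - 1ℤ ≡ a
    undo = solve-∀
    redo : ∀ a → a - 1ℤ + 1ℤ ≡ a
    redo = solve-∀
  stay-between q S x (inj₂ (inj₁ refl)) between _ = subst (Between q) (sym (ℤP.+-identityʳ S)) between
  stay-between q S x (inj₂ (inj₂ refl)) (lo , hi) ¬n∣ =
    ℤP.<-trans lo (subst (_< S + 1ℤ) (ℤP.+-identityʳ S) (ℤP.+-monoʳ-< S (+<+ (s≤s z≤n)))) ,
    below-multiple (q + 1ℤ) (S + 1ℤ) (<⇒+1≤ hi) ¬n∣

  -- Entering the strip: right after the left pivot the partial sum has left the
  -- multiple J = S_{P_l} and lies in a strip of which J is an end.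
  record StripAt (P : ℕ) : Set where
    constructor strip-at
    field
      q       : ℤ
      J-end   : psum v P ≡ q * + n ⊎ psum v P ≡ (q + 1ℤ) * + n
      entered : Between q (psum v (suc P))

  -- n ≥ 2 leaves room for the steps ±1 off a multiple of n.
  n≥2ℤ : + 2 ≤ + n
  n≥2ℤ = +≤+ (s≤s n≥2)

  strip-entry : ∀ P → P ≡ Pl → StripAt P
  strip-entry zero P≡Pl = strip-at 0ℤ (inj₁ refl) $
    above-multiple 0ℤ (psum v 1) (subst (0ℤ ≤_) (sym (ℤP.+-identityˡ (v 0))) (proj₁ (proj₁ V)))
      (no-pivot-between 1 (subst (ℕ._< 1) P≡Pl (s≤s z≤n)) (subst (λ x → suc (suc x) ℕ.≤ Pr) (sym P≡Pl) Pl+2≤Pr)) ,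
    subst₂ _<_ (sym (ℤP.+-identityˡ (v 0))) (sym (ℤP.*-identityˡ (+ n))) (proj₂ (proj₁ V))
  strip-entry (suc P) P≡Pl with quotient {x = psum v (suc P)} (subst (λ x → + n ∣ psum v x) (sym P≡Pl) (proj₂ Pl-pivot))
                              | inner (suc P) (s≤s z≤n) (subst (ℕ._≤ m) (sym P≡Pl) Pl≤m)
  ... | γ , eγ | inj₁ v≡-1 = strip-at (γ - 1ℤ) (inj₂ (trans eγ (cong (_* + n) (redo γ)))) $
    +1≤⇒< (by-certificate (n≥2ℤ ∷ₗ []ₗ) (trans (cong (_- ((γ - 1ℤ) * + n + 1ℤ)) S≡) (down γ (+ n)))) ,
    +1≤⇒< (ℤP.≤-reflexive (trans (cong (_+ 1ℤ) S≡) (back γ (+ n))))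
    where
    S≡ : psum v (suc (suc P)) ≡ γ * + n - 1ℤ
    S≡ = cong₂ _+_ eγ v≡-1
    redo : ∀ g → g ≡ g - 1ℤ + 1ℤ
    redo = solve-∀
    down : ∀ g N → g * N - 1ℤ - ((g - 1ℤ) * N + 1ℤ) ≡ N - + 2 + 0ℤ
    down = solve-∀
    back : ∀ g N → g * N - 1ℤ + 1ℤ ≡ (g - 1ℤ + 1ℤ) * N
    back = solve-∀
  ... | γ , eγ | inj₂ (inj₁ v≡0) = ⊥-elim (no-pivot-between (suc (suc P)) (subst (ℕ._< suc (suc P)) P≡Pl (ℕP.n<1+n _))
           (subst (λ x → suc x ℕ.< Pr) (sym P≡Pl) Pl+2≤Pr)
           (divides-by γ (trans (cong₂ _+_ eγ v≡0) (ℤP.+-identityʳ (γ * + n)))))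
  ... | γ , eγ | inj₂ (inj₂ v≡1) = strip-at γ (inj₁ eγ) $
    +1≤⇒< (ℤP.≤-reflexive (sym S≡)) ,
    +1≤⇒< (by-certificate (n≥2ℤ ∷ₗ []ₗ) (trans (cong (λ s → (γ + 1ℤ) * + n - (s + 1ℤ)) S≡) (up γ (+ n))))
    where
    S≡ : psum v (suc (suc P)) ≡ γ * + n + 1ℤ
    S≡ = cong₂ _+_ eγ v≡1
    up : ∀ g N → (g + 1ℤ) * N - (g * N + 1ℤ + 1ℤ) ≡ N - + 2 + 0ℤ
    up = solve-∀

  abstract
    strip-level : StripAt Pl
    strip-level = strip-entry Pl refl

  open StripAt strip-level

  strip : ∀ Q → Pl ℕ.< Q → Q ℕ.< Pr → Between q (psum v Q)
  strip Q Pl<Q Q<Pr = subst (Between q ∘ psum v) (ℕP.m∸n+n≡m Pl<Q) (from (Q ∸ suc Pl) (subst (ℕ._< Pr) (sym (ℕP.m∸n+n≡m Pl<Q)) Q<Pr))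
    where
    from : ∀ d → d ℕ.+ suc Pl ℕ.< Pr → Between q (psum v (d ℕ.+ suc Pl))
    from zero    _   = entered
    from (suc d) lt = stay-between q _ _
      (inner (d ℕ.+ suc Pl) (ℕP.≤-trans (s≤s z≤n) (ℕP.m≤n+m (suc Pl) d)) (ℕP.≤-pred (ℕP.≤-pred (ℕP.≤-trans lt Pr≤m+2))))
      (from d (ℕP.<-trans (ℕP.n<1+n _) lt))
      (no-pivot-between (suc (d ℕ.+ suc Pl)) (s≤s (ℕP.≤-trans (ℕP.n≤1+n Pl) (ℕP.m≤n+m (suc Pl) d))) lt)

  pairDev : ℤ → ℤ
  pairDev S = abs (S - q * + n) + abs (S - (q + 1ℤ) * + n)

  J : ℤ
  J = psum v Pl

  pairDev-J : pairDev J ≡ + n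
  pairDev-J with J-end
  ... | inj₁ J≡ = begin
    abs (J - q * + n) + abs (J - (q + 1ℤ) * + n)
      ≡⟨ cong₂ (λ a b → abs (a - q * + n) + abs (b - (q + 1ℤ) * + n)) J≡ J≡ ⟩
    abs (q * + n - q * + n) + abs (q * + n - (q + 1ℤ) * + n)
      ≡⟨ cong₂ (λ a b → abs a + abs b) (ℤP.+-inverseʳ (q * + n)) (one-below q (+ n)) ⟩
    0ℤ + abs (- + n)
      ≡⟨ trans (ℤP.+-identityˡ _) (cong +_ (ℤP.∣-i∣≡∣i∣ (+ n))) ⟩
    + n ∎
    where
    open ≡-Reasoning
    one-below : ∀ q N → q * N - (q + 1ℤ) * N ≡ - N
    one-below = solve-∀
  ... | inj₂ J≡ = begin
    abs (J - q * + n) + abs (J - (q + 1ℤ) * + n)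
      ≡⟨ cong₂ (λ a b → abs (a - q * + n) + abs (b - (q + 1ℤ) * + n)) J≡ J≡ ⟩
    abs ((q + 1ℤ) * + n - q * + n) + abs ((q + 1ℤ) * + n - (q + 1ℤ) * + n)
      ≡⟨ cong₂ (λ a b → abs a + abs b) (one-above q (+ n)) (ℤP.+-inverseʳ ((q + 1ℤ) * + n)) ⟩
    + n + 0ℤ
      ≡⟨ ℤP.+-identityʳ (+ n) ⟩
    + n ∎
    where
    open ≡-Reasoning
    one-above : ∀ q N → (q + 1ℤ) * N - q * N ≡ N
    one-above = solve-∀

  pairDev-bound : ∀ S → pairDev S ≤ + 2 * abs (S - J) + + n
  pairDev-bound S = begin
    abs (S - q * + n) + abs (S - (q + 1ℤ) * + n)
      ≤⟨ ℤP.+-mono-≤ (via J (q * + n)) (via J ((q + 1ℤ) * + n)) ⟩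
    abs (S - J) + abs (J - q * + n) + (abs (S - J) + abs (J - (q + 1ℤ) * + n))
      ≡⟨ regroup (abs (S - J)) (abs (J - q * + n)) (abs (J - (q + 1ℤ) * + n)) ⟩
    + 2 * abs (S - J) + pairDev J
      ≡⟨ cong (λ t → + 2 * abs (S - J) + t) pairDev-J ⟩
    + 2 * abs (S - J) + + n ∎
    where
    open ℤP.≤-Reasoning
    via : ∀ J L → abs (S - L) ≤ abs (S - J) + abs (J - L)
    via J L = subst (λ t → abs t ≤ abs (S - J) + abs (J - L)) (telescope S J L) (abs-triangle (S - J) (J - L))
      where
      telescope : ∀ S J L → S - J + (J - L) ≡ S - L
      telescope = solve-∀
    regroup : ∀ D a b → D + a + (D + b) ≡ + 2 * D + (a + b)
    regroup = solve-∀

  abs-inner : ∀ j → 1 ℕ.≤ j → j ℕ.≤ m → abs (v j) ≤ 1ℤ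
  abs-inner j 1≤j j≤m with inner j 1≤j j≤m
  ... | inj₁ v≡        = ℤP.≤-reflexive (cong abs v≡)
  ... | inj₂ (inj₁ v≡) = subst (_≤ 1ℤ) (sym (cong abs v≡)) (+≤+ z≤n)
  ... | inj₂ (inj₂ v≡) = ℤP.≤-reflexive (cong abs v≡)

  lipschitz : ∀ P d → 1 ℕ.≤ P → d ℕ.+ P ℕ.≤ suc m → abs (psum v (d ℕ.+ P) - psum v P) ≤ + d
  lipschitz P zero    _   _ = ℤP.≤-reflexive (cong abs (ℤP.+-inverseʳ (psum v P)))
  lipschitz P (suc d) 1≤P d+P≤ = begin
    abs (psum v (d ℕ.+ P) + v (d ℕ.+ P) - psum v P)
      ≡⟨ cong abs (regroup (psum v (d ℕ.+ P)) (v (d ℕ.+ P)) (psum v P)) ⟩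
    abs (psum v (d ℕ.+ P) - psum v P + v (d ℕ.+ P))
      ≤⟨ abs-triangle (psum v (d ℕ.+ P) - psum v P) (v (d ℕ.+ P)) ⟩
    abs (psum v (d ℕ.+ P) - psum v P) + abs (v (d ℕ.+ P))
      ≤⟨ ℤP.+-mono-≤ (lipschitz P d 1≤P (ℕP.<⇒≤ d+P≤)) (abs-inner (d ℕ.+ P) (ℕP.≤-trans 1≤P (ℕP.m≤n+m P d)) (ℕP.≤-pred d+P≤)) ⟩
    + d + 1ℤ
      ≡⟨ sym (+suc d) ⟩
    + suc d ∎
    where
    open ℤP.≤-Reasoning
    regroup : ∀ a b c → a + b - c ≡ (a - c) + b
    regroup = solve-∀

  -- Before the strip S_{i+1} is within P_l - i - 1 of J,
  -- inside it the pair sums to n, after it S_{i+1} is within i + 1 - P_r of J.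
  target : ℕ → ℤ
  target i = abs (+ i - + c) + abs (+ i - (+ m - + c))

  before-strip : ∀ i → suc i ℕ.≤ Pl → pairDev (psum v (suc i)) + + e ≤ target i
  before-strip i i<Pl = by-certificate
    (pairDev-bound S ∷ₗ 2 ×ₗ near ∷ₗ 2 ×ₗ Pl-small ∷ₗ neg≤abs (+ i - + c) ∷ₗ neg≤abs (+ i - (+ m - + c)) ∷ₗ []ₗ)
    (balance (pairDev S) (abs (S - J)) (+ d) (+ i) (+ c) (+ e) (+ n) (abs (+ i - + c)) (abs (+ i - (+ m - + c))) (+ Pl) (+ m) d+i+1≡Pl m-eq)
    where
    S : ℤ
    S = psum v (suc i)
    d : ℕ
    d = Pl ∸ suc i
    d+i+1 : d ℕ.+ suc i ≡ Pl
    d+i+1 = ℕP.m∸n+n≡m i<Pl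
    d+i+1≡Pl : + Pl ≡ + d + (+ i + 1ℤ)
    d+i+1≡Pl = sym (trans (cong (λ t → + d + t) (sym (+suc i))) (trans (sym (ℤP.pos-+ d (suc i))) (cong +_ d+i+1)))
    near : abs (S - J) ≤ + d
    near = subst (_≤ + d) (trans (cong (λ x → abs (psum v x - S)) d+i+1) (abs-flip J S))
             (lipschitz (suc i) d (s≤s z≤n) (subst (ℕ._≤ suc m) (sym d+i+1) (ℕP.≤-trans Pl≤m (ℕP.n≤1+n m))))
    balance : ∀ T D d I C E N A₁ A₂ P M → P ≡ d + (I + 1ℤ) → M ≡ N + + 2 * C + E →
      A₁ + A₂ - (T + E) ≡ (+ 2 * D + N - T) + ((+ 2 * d - + 2 * D) + ((+ 2 * (C + 1ℤ) - + 2 * P)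
        + ((A₁ - - (I - C)) + ((A₂ - - (I - (M - C))) + 0ℤ))))
    balance T D d I C E N A₁ A₂ _ _ refl refl = identity T D d I C E N A₁ A₂
      where
      identity : ∀ T D d I C E N A₁ A₂ → A₁ + A₂ - (T + E) ≡ (+ 2 * D + N - T) + ((+ 2 * d - + 2 * D)
        + ((+ 2 * (C + 1ℤ) - + 2 * (d + (I + 1ℤ))) + ((A₁ - - (I - C)) + ((A₂ - - (I - (N + + 2 * C + E - C))) + 0ℤ))))
      identity = solve-∀

  inside-strip : ∀ i → Pl ℕ.< suc i → suc i ℕ.< Pr → pairDev (psum v (suc i)) + + e ≤ target i
  inside-strip i Pl<i+1 i+1<Pr = by-certificate
    (ℤP.≤-reflexive (abs-of-nonneg (ℤP.i≤j⇒0≤j-i (ℤP.<⇒≤ (proj₁ between)))) ∷ₗ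
     ℤP.≤-reflexive (abs-of-nonpos (ℤP.i≤j⇒i-j≤0 (ℤP.<⇒≤ (proj₂ between)))) ∷ₗ
     ≤abs (+ i - + c) ∷ₗ neg≤abs (+ i - (+ m - + c)) ∷ₗ []ₗ)
    (balance (abs (S - q * + n)) (abs (S - (q + 1ℤ) * + n)) S q (+ i) (+ c) (+ e) (+ n) (abs (+ i - + c)) (abs (+ i - (+ m - + c))) (+ m) m-eq)
    where
    S : ℤ
    S = psum v (suc i)
    between : Between q (psum v (suc i))
    between = strip (suc i) Pl<i+1 i+1<Pr
    balance : ∀ T₁ T₂ S q I C E N A₁ A₂ M → M ≡ N + + 2 * C + E →
      A₁ + A₂ - (T₁ + T₂ + E) ≡ (S - q * N - T₁) + ((- (S - (q + 1ℤ) * N) - T₂) + ((A₁ - (I - C)) + ((A₂ - - (I - (M - C))) + 0ℤ)))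
    balance T₁ T₂ S q I C E N A₁ A₂ _ refl = identity T₁ T₂ S q I C E N A₁ A₂
      where
      identity : ∀ T₁ T₂ S q I C E N A₁ A₂ → A₁ + A₂ - (T₁ + T₂ + E) ≡
        (S - q * N - T₁) + ((- (S - (q + 1ℤ) * N) - T₂) + ((A₁ - (I - C)) + ((A₂ - - (I - (N + + 2 * C + E - C))) + 0ℤ)))
      identity = solve-∀

  after-strip : ∀ i → i ℕ.≤ m → Pr ℕ.≤ suc i → pairDev (psum v (suc i)) + + e ≤ target i
  after-strip i i≤m Pr≤i+1 = by-certificate
    (pairDev-bound S ∷ₗ 2 ×ₗ near ∷ₗ 2 ×ₗ Pr-large ∷ₗ ≤abs (+ i - + c) ∷ₗ ≤abs (+ i - (+ m - + c)) ∷ₗ []ₗ)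
    (balance (pairDev S) (abs (S - J)) (+ d) (+ i) (+ c) (+ e) (+ n) (abs (+ i - + c)) (abs (+ i - (+ m - + c))) (+ Pr) (+ m) Pr≡ m-eq)
    where
    S : ℤ
    S = psum v (suc i)
    d : ℕ
    d = suc i ∸ Pr
    d+Pr : d ℕ.+ Pr ≡ suc i
    d+Pr = ℕP.m∸n+n≡m Pr≤i+1
    Pr≡ : + Pr ≡ + i + 1ℤ - + d
    Pr≡ = trans (sym (cancel (+ d) (+ Pr))) (cong (_- + d) (trans (cong +_ d+Pr) (+suc i)))
      where
      cancel : ∀ d p → d + p - d ≡ p
      cancel = solve-∀
    near : abs (S - J) ≤ + d
    near = subst (_≤ + d) (cong₂ (λ x y → abs (psum v x - y)) d+Pr central-sum)
             (lipschitz Pr d (ℕP.≤-trans (s≤s z≤n) Pl+2≤Pr) (subst (ℕ._≤ suc m) (sym d+Pr) (s≤s i≤m)))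
    balance : ∀ T D d I C E N A₁ A₂ R M → R ≡ I + 1ℤ - d → M ≡ N + + 2 * C + E →
      A₁ + A₂ - (T + E) ≡ (+ 2 * D + N - T) + ((+ 2 * d - + 2 * D) + ((+ 2 * R - + 2 * (M - C + 1ℤ))
        + ((A₁ - (I - C)) + ((A₂ - (I - (M - C))) + 0ℤ))))
    balance T D d I C E N A₁ A₂ _ _ refl refl = identity T D d I C E N A₁ A₂
      where
      identity : ∀ T D d I C E N A₁ A₂ → A₁ + A₂ - (T + E) ≡ (+ 2 * D + N - T) + ((+ 2 * d - + 2 * D)
        + ((+ 2 * (I + 1ℤ - d) - + 2 * (N + + 2 * C + E - C + 1ℤ)) + ((A₁ - (I - C)) + ((A₂ - (I - (N + + 2 * C + E - C))) + 0ℤ))))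
      identity = solve-∀

  pointwise : ∀ i → i ℕ.≤ m → pairDev (psum v (suc i)) + + e ≤ target i
  pointwise i i≤m with suc i ℕ.≤? Pl
  ... | yes i<Pl = before-strip i i<Pl
  ... | no i≮Pl with suc i ℕ.<? Pr
  ...   | yes i+1<Pr = inside-strip i (ℕP.≰⇒> i≮Pl) i+1<Pr
  ...   | no i+1≮Pr  = after-strip i i≤m (ℕP.≮⇒≥ i+1≮Pr)

  two-level-bound : potential n m v q + potential n m v (q + 1ℤ) + + (suc m) * + e ≤ distSum (suc m) (+ c) + distSum (suc m) (+ m - + c)
  two-level-bound = subst₂ _≤_ split (psum-+ _ _ (suc m)) (psum-mono _ _ (suc m) (λ i i≤m → pointwise i (ℕP.≤-pred i≤m)))
    where
    split : psum (λ i → pairDev (psum v (suc i)) + + e) (suc m) ≡ potential n m v q + potential n m v (q + 1ℤ) + + (suc m) * + e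
    split = trans (psum-+ _ _ (suc m)) (cong₂ _+_ (psum-+ _ _ (suc m)) (psum-const (+ e) (suc m)))

  -- Main estimate for v: at the better of the two levels q, q + 1,
  --   4 Φ_v(k) + 2 (m+1) e ≤ (n+e)² + m(m+2).
  v-bound : Σ ℤ λ k → + 4 * potential n m v k + + 2 * ((+ m + 1ℤ) * + e) ≤ (+ n + + e) * (+ n + + e) + + m * (+ m + + 2)
  v-bound with better-of-two (potential n m v) q (q + 1ℤ)
  ... | k , 2Φk≤ = k , halve-≤ (by-certificate
      (4 ×ₗ 2Φk≤ ∷ₗ 4 ×ₗ subst (λ M → Φq + Φq+1 + M * + e ≤ G₁ + G₂) (+suc m) two-level-bound ∷ₗ
       ℤP.≤-reflexive closed₁ ∷ₗ ℤP.≤-reflexive closed₂ ∷ₗ []ₗ)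
      (balance (potential n m v k) Φq Φq+1 G₁ G₂ (+ n) (+ c) (+ e) (+ m) m-eq))
    where
    Φq : ℤ
    Φq = potential n m v q
    Φq+1 : ℤ
    Φq+1 = potential n m v (q + 1ℤ)
    G₁ : ℤ
    G₁ = distSum (suc m) (+ c)
    G₂ : ℤ
    G₂ = distSum (suc m) (+ m - + c)
    c≤m : + c ≤ + m
    c≤m = by-certificate (+≤+ (z≤n {n}) ∷ₗ +≤+ (z≤n {c}) ∷ₗ +≤+ (z≤n {e}) ∷ₗ []ₗ) (trans (cong (_- + c) m-eq) (spread (+ n) (+ c) (+ e)))
      where
      spread : ∀ N C E → N + + 2 * C + E - C ≡ (N - + 0) + ((C - + 0) + ((E - + 0) + 0ℤ))
      spread = solve-∀
    closed₁ : + 4 * G₁ ≡ (+ 2 * + c - + m) * (+ 2 * + c - + m) + + m * (+ m + + 2)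
    closed₁ = distSum-closed m (+ c) (+≤+ z≤n) c≤m
    closed₂ : + 4 * G₂ ≡ (+ 2 * (+ m - + c) - + m) * (+ 2 * (+ m - + c) - + m) + + m * (+ m + + 2)
    closed₂ = distSum-closed m (+ m - + c) (ℤP.i≤j⇒0≤j-i c≤m)
      (subst (+ m - + c ≤_) (ℤP.+-identityʳ (+ m)) (ℤP.+-monoʳ-≤ (+ m) (ℤP.neg-mono-≤ (+≤+ (z≤n {c})))))
    balance : ∀ Φk Φq Φq+1 G₁ G₂ N C E M → M ≡ N + + 2 * C + E →
      + 2 * ((N + E) * (N + E) + M * (M + + 2)) - + 2 * (+ 4 * Φk + + 2 * ((M + 1ℤ) * E)) ≡
      (+ 4 * (Φq + Φq+1) - + 4 * (+ 2 * Φk)) + ((+ 4 * (G₁ + G₂) - + 4 * (Φq + Φq+1 + (M + 1ℤ) * E))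
        + ((((+ 2 * C - M) * (+ 2 * C - M) + M * (M + + 2)) - + 4 * G₁)
        + ((((+ 2 * (M - C) - M) * (+ 2 * (M - C) - M) + M * (M + + 2)) - + 4 * G₂) + 0ℤ)))
    balance Φk Φq Φq+1 G₁ G₂ N C E _ refl = identity Φk Φq Φq+1 G₁ G₂ N C E
      where
      identity : ∀ Φk Φq Φq+1 G₁ G₂ N C E → let M = N + + 2 * C + E in
        + 2 * ((N + E) * (N + E) + M * (M + + 2)) - + 2 * (+ 4 * Φk + + 2 * ((M + 1ℤ) * E)) ≡
        (+ 4 * (Φq + Φq+1) - + 4 * (+ 2 * Φk)) + ((+ 4 * (G₁ + G₂) - + 4 * (Φq + Φq+1 + (M + 1ℤ) * E))
          + ((((+ 2 * C - M) * (+ 2 * C - M) + M * (M + + 2)) - + 4 * G₁)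
          + ((((+ 2 * (M - C) - M) * (+ 2 * (M - C) - M) + M * (M + + 2)) - + 4 * G₂) + 0ℤ)))
      identity = solve-∀

-- The final comparisons: in the even case 4 Φ_v ≤ n² + m(m+2) ≤ 4 Φ_{u⁰}, in the odd
-- case 4 Φ_v ≤ n² + m² + 2n - 1 ≤ 4 Φ_{u¹} + 2; either way Φ_v ≤ Φ_u ≤ K.
compare-even : ∀ {Φv Φu K N M} → + 4 * Φv + + 2 * ((M + 1ℤ) * + 0) ≤ (N + + 0) * (N + + 0) + M * (M + + 2) →
  N * N + M * (M + + 2) ≤ + 4 * Φu → Φu ≤ K → Φv ≤ K
compare-even {Φv} {Φu} {K} {N} {M} v-bound u-bound Φu≤K =
  quarter-≤ (by-certificate (v-bound ∷ₗ u-bound ∷ₗ 4 ×ₗ Φu≤K ∷ₗ +≤+ (z≤n {3}) ∷ₗ []ₗ) (balance Φv Φu K N M))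
  where
  balance : ∀ Φv Φu K N M → + 4 * K + + 3 - + 4 * Φv ≡
    (((N + 0ℤ) * (N + 0ℤ) + M * (M + + 2)) - (+ 4 * Φv + + 2 * ((M + 1ℤ) * 0ℤ)))
      + ((+ 4 * Φu - (N * N + M * (M + + 2))) + ((+ 4 * K - + 4 * Φu) + ((+ 3 - + 0) + 0ℤ)))
  balance = solve-∀

compare-odd : ∀ {Φv Φu K N M} → + 4 * Φv + + 2 * ((M + 1ℤ) * + 1) ≤ (N + + 1) * (N + + 1) + M * (M + + 2) →
  N * N + M * M + + 2 * N ≤ + 4 * Φu + + 3 → Φu ≤ K → Φv ≤ K
compare-odd {Φv} {Φu} {K} {N} {M} v-bound u-bound Φu≤K =
  quarter-≤ (by-certificate (v-bound ∷ₗ u-bound ∷ₗ 4 ×ₗ Φu≤K ∷ₗ +≤+ (z≤n {1}) ∷ₗ []ₗ) (balance Φv Φu K N M))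
  where
  balance : ∀ Φv Φu K N M → + 4 * K + + 3 - + 4 * Φv ≡
    (((N + 1ℤ) * (N + 1ℤ) + M * (M + + 2)) - (+ 4 * Φv + + 2 * ((M + 1ℤ) * 1ℤ)))
      + (((+ 4 * Φu + + 3) - (N * N + M * M + + 2 * N)) + ((+ 4 * K - + 4 * Φu) + ((+ 1 - + 0) + 0ℤ)))
  balance = solve-∀

lemma5p30 : (n m : ℕ) → 1 ℕ.< n → n ℕ.≤ m → (v : Tuple) → Vertex n m v →
    HGe n m v → CentralZero n m v → DistLeD n m v
lemma5p30 (suc (suc n″)) m (s≤s (s≤s z≤n)) n≤m v V HG CZ = even-case , odd-case
  where
  open Split (suc n″) m n≤m using (n; e; u⁰-lower; u¹-lower)
  open CentralStrip (suc n″) m n≤m (s≤s z≤n) v V HG CZ using (v-bound)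
  open Greedy (suc n″) m using (distance-upper)
  k : ℤ
  k = proj₁ v-bound
  bound-at : ∀ {E} → e ≡ E → + 4 * potential n m v k + + 2 * ((+ m + 1ℤ) * + E) ≤ (+ n + + E) * (+ n + + E) + + m * (+ m + + 2)
  bound-at e≡E = subst (λ E → + 4 * potential n m v k + + 2 * ((+ m + 1ℤ) * + E) ≤ (+ n + + E) * (+ n + + E) + + m * (+ m + + 2))
                   e≡E (proj₂ v-bound)

  even-case : e ≡ 0 → ∀ K → DistLE n m (u⁰ n m) zeroV K → DistLE n m v zeroV K
  even-case e≡0 K walk⁰ with distance-lower walk⁰
  ... | t , Φ⁰≤K = distance-upper K v k V (compare-even {N = + n} {M = + m} (bound-at e≡0) (u⁰-lower e≡0 t) Φ⁰≤K)

  odd-case : e ≡ 1 → ∀ K → DistLE n m (u⁰ n m) zeroV K → DistLE n m (u¹ n m) zeroV K → DistLE n m v zeroV K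
  odd-case e≡1 K _ walk¹ with distance-lower walk¹
  ... | t , Φ¹≤K = distance-upper K v k V (compare-odd {N = + n} {M = + m} (bound-at e≡1) (u¹-lower e≡1 t) Φ¹≤K)
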